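{- Let $n,k\ge1$ and $w\in\{0,1\}^{n-1}$. (a) $d_{n+k}(w0^k)\le\binom{n+k}{k}d_n(w)$. (b) If $w$ ends with the letter $0$, then $d_{n+k}\big(w(10)^{k/2}\big)\ge\frac12\binom{n+k}{k}E_k\,d_n(w)$.
   Context: $\{0,1\}^{m}$ is the set of binary words of length $m$; $x^r$ denotes $r$-fold concatenation of a word $x$, and juxtaposition denotes concatenation. For odd $k$, $(10)^{k/2}$ denotes the word $(10)^{(k-1)/2}1$ (of length $k$); for even $k$ it is the usual $(10)^{k/2}$. For $\pi\in\mathfrak{S}_m$, $\mathrm{Des}(\pi)=x_1\cdots x_{m-1}$ with $x_i=1$ iff $\pi_i>\pi_{i+1}$, and for a binary word $u$ of length $m-1$, $d_m(u)$ is the number of $\pi\in\mathfrak{S}_m$ with $\mathrm{Des}(\pi)=u$. $E_k$ is the $k$-th Euler (zigzag) number, defined by $\sum_{k\ge0}E_k x^k/k!=\tan x+\sec x$; equivalently $E_k$ is the number of alternating permutations in $\mathfrak{S}_k$ (those with descent word $1010\cdots$ of length $k-1$). -}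

module Defs where

open import Data.Nat using (ℕ; zero; suc; _∸_)
open import Data.Bool using (Bool; true; false)
import Data.Bool as Bool
open import Data.Fin using (Fin; _<?_)
import Data.Fin.Properties as FinP
open import Data.List using (List; []; _∷_; _++_; length; filter; map; concatMap; replicate; allFin)
open import Data.List.Properties using (≡-dec)
open import Data.Vec using (Vec; []; _∷_; toList)
open import Data.Product using (_×_)
open import Relation.Nullary using (Dec; yes; no; ¬?)
open import Relation.Nullary.Decidable using (_×-dec_; ⌊_⌋)
open import Relation.Binary.PropositionalEquality using (_≡_)
open import Data.List.Relation.Unary.Unique.Propositional using (Unique)
import Data.List.Relation.Unary.AllPairs as AllPairs

import Data.Vec as Vec

allVecs : {A : Set} → List A → (m : ℕ) → List (Vec A m)
allVecs xs zero    = [] ∷ []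
allVecs xs (suc m) = concatMap (λ x → map (x ∷_) (allVecs xs m)) xs

-- A permutation of {1..m} in one-line notation: a vector (π₁,…,πₘ) with entries in Fin m,
-- all distinct (hence a bijection of Fin m).
IsPerm : {m : ℕ} → Vec (Fin m) m → Set
IsPerm v = Unique (toList v)

isPerm? : {m : ℕ} → (v : Vec (Fin m) m) → Dec (IsPerm v)
isPerm? v = AllPairs.allPairs? (λ x y → ¬? (x FinP.≟ y)) (toList v)

-- Descent word of a list: x_i = true (letter 1) iff π_i > π_{i+1}.
desL : {m : ℕ} → List (Fin m) → List Bool
desL []           = []
desL (x ∷ [])     = []
desL (x ∷ y ∷ xs) = ⌊ y <? x ⌋ ∷ desL (y ∷ xs)

Des : {m : ℕ} → Vec (Fin m) m → List Bool
Des v = desL (toList v)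

d : ℕ → List Bool → ℕ
d m u = length (filter (λ v → isPerm? v ×-dec ≡-dec Bool._≟_ (Des v) u) (allVecs (allFin m) m))

-- The word 1010… of length j  (so alt k is (10)^{k/2} in the paper's notation).
alt : ℕ → List Bool
alt zero          = []
alt (suc zero)    = true ∷ []
alt (suc (suc j)) = true ∷ false ∷ alt j

zeros : ℕ → List Bool
zeros k = replicate k false

E : ℕ → ℕ
E k = d k (alt (k ∸ 1))

-- Let firstCount m u j be the number of permutations of {0,…,m} with descent word u and
-- first entry j; it obeys a linear recursion in the first letter of u.  Cutting a permutation
-- of length n + k after position n gives d_{n+k}(w p) = ∑ₛ firstCount k p s · φ(s), where the
-- weight φ(s) depends only on w and on the rank s of the first entry of the tail, and
-- ∑ₛ φ(s) = C(n+k,k) d_n(w), because summing d_{n+k}(w p) over all words p counts the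
-- permutations whose first n entries have descent word w.
-- (a) For p = 0^k the tail is increasing, so only s = 0 contributes.
-- (b) For p = (10)^{k/2} the distribution a(s) = firstCount k p s increases in s, with
-- a(k) = E_k and a(k) ≤ a(s) + a(k-s); if w ends with an ascent then φ increases as well,
-- and Chebyshev's sum inequality gives a(k) ∑ₛ φ(s) ≤ 2 ∑ₛ a(s) φ(s).

module Submission where

open import Defs
open import Data.Nat using (ℕ; zero; suc; _+_; _<?_; _*_; _∸_; _≤_; _<_; z≤n; s≤s; s≤s⁻¹; _<ᵇ_; _≡ᵇ_; _!)
open import Data.Nat.Properties
open import Data.Nat.Combinatorics using (_C_; nCn≡1; nCk+nC[k+1]≡[n+1]C[k+1])
open import Data.Bool using (Bool; true; false; not; _∧_)
import Data.Bool as Bool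
import Data.Bool.Properties as BoolP
open import Data.Bool.ListAction using (all)
open import Data.Fin using (Fin; zero; suc; toℕ; punchIn)
import Data.Fin as Fin
import Data.Fin.Properties as FinP
open import Data.List using (List; []; _∷_; _∷ʳ_; _++_; map; length; concatMap; allFin; filter; filterᵇ; reverse; last)
import Data.List.Properties as ListP
import Data.List.Relation.Unary.All as All
import Data.List.Relation.Unary.AllPairs as AllPairs
import Data.List.Relation.Unary.Unique.Propositional.Properties as UniqueP
open import Data.List.Relation.Unary.Unique.Propositional using (Unique)
import Data.List.Relation.Binary.Permutation.Setoid as Perm
import Data.List.Relation.Binary.Permutation.Setoid.Properties as PermP
open import Data.Vec using (Vec; []; _∷_; toList)
import Data.Vec as Vec
import Data.Vec.Properties as VecP
open import Data.Maybe using (just)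
open import Data.Product using (_×_; _,_; ∃)
open import Data.Sum using (inj₁; inj₂)
open import Data.Empty using (⊥-elim)
open import Function using (_∘′_)
open import Function.Bundles using (mk⇔)
open import Algebra.Bundles using (CommutativeMonoid)
open import Relation.Nullary using (Dec; yes; no; does; ¬?)
open import Relation.Nullary.Decidable using (⌊_⌋; ⌊⌋-map′; does-⇔; T?)
open import Relation.Binary.PropositionalEquality
open import Algebra.Properties.CommutativeSemigroup +-commutativeSemigroup
  using (interchange) renaming (x∙yz≈y∙xz to +-x∙yz≈y∙xz)
open import Algebra.Properties.CommutativeSemigroup *-commutativeSemigroup
  renaming (x∙yz≈y∙xz to *-x∙yz≈y∙xz) using ()
open import Algebra.Properties.CommutativeSemigroup (CommutativeMonoid.commutativeSemigroup BoolP.∧-commutativeMonoid)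
  renaming (x∙yz≈y∙xz to ∧-x∙yz≈y∙xz) using ()
open ≡-Reasoning
open import Data.Nat.Tactic.RingSolver using (solve-∀)

private
  variable
    A B : Set

𝟙 : Bool → ℕ
𝟙 true  = 1
𝟙 false = 0

𝟙≤1 : ∀ b → 𝟙 b ≤ 1
𝟙≤1 true  = s≤s z≤n
𝟙≤1 false = z≤n

𝟙-∧ : ∀ a b → 𝟙 (a ∧ b) ≡ 𝟙 a * 𝟙 b
𝟙-∧ true  b = sym (+-identityʳ (𝟙 b))
𝟙-∧ false b = refl

<⇒<ᵇ≡true : ∀ {m n} → m < n → (m <ᵇ n) ≡ true
<⇒<ᵇ≡true {zero}  {suc n} _         = refl
<⇒<ᵇ≡true {suc m} {suc n} (s≤s m<n) = <⇒<ᵇ≡true m<n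

≥⇒<ᵇ≡false : ∀ {m n} → n ≤ m → (m <ᵇ n) ≡ false
≥⇒<ᵇ≡false {m}     {zero}  _         = refl
≥⇒<ᵇ≡false {suc m} {suc n} (s≤s n≤m) = ≥⇒<ᵇ≡false n≤m

<ᵇ-∸ʳ : ∀ s N j → j ≤ N → (s <ᵇ (N ∸ j)) ≡ (s + j <ᵇ N)
<ᵇ-∸ʳ s N       zero    _         = cong (_<ᵇ N) (sym (+-identityʳ s))
<ᵇ-∸ʳ s (suc N) (suc j) (s≤s j≤N) = trans (<ᵇ-∸ʳ s N j j≤N) (cong (_<ᵇ suc N) (sym (+-suc s j)))

+-cancelˡ-<ᵇ : ∀ s m n → (s + m <ᵇ s + n) ≡ (m <ᵇ n)
+-cancelˡ-<ᵇ zero    m n = refl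
+-cancelˡ-<ᵇ (suc s) m n = +-cancelˡ-<ᵇ s m n

m<ᵇn≡not[n<ᵇ1+m] : ∀ m n → (m <ᵇ n) ≡ not (n <ᵇ suc m)
m<ᵇn≡not[n<ᵇ1+m] zero    zero    = refl
m<ᵇn≡not[n<ᵇ1+m] zero    (suc n) = refl
m<ᵇn≡not[n<ᵇ1+m] (suc m) zero    = refl
m<ᵇn≡not[n<ᵇ1+m] (suc m) (suc n) = m<ᵇn≡not[n<ᵇ1+m] m n

not-≟-not : ∀ b c → does (not b Bool.≟ not c) ≡ does (b Bool.≟ c)
not-≟-not true  true  = refl
not-≟-not true  false = refl
not-≟-not false true  = refl
not-≟-not false false = refl

-- Finite sums

∑< : ℕ → (ℕ → ℕ) → ℕ
∑< zero    f = 0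
∑< (suc N) f = ∑< N f + f N

∑<-cong : ∀ N {f g : ℕ → ℕ} → (∀ i → i < N → f i ≡ g i) → ∑< N f ≡ ∑< N g
∑<-cong zero    f≡g = refl
∑<-cong (suc N) f≡g = cong₂ _+_ (∑<-cong N (λ i i<N → f≡g i (m<n⇒m<1+n i<N))) (f≡g N ≤-refl)

∑<-mono-≤ : ∀ N {f g : ℕ → ℕ} → (∀ i → i < N → f i ≤ g i) → ∑< N f ≤ ∑< N g
∑<-mono-≤ zero    f≤g = z≤n
∑<-mono-≤ (suc N) f≤g = +-mono-≤ (∑<-mono-≤ N (λ i i<N → f≤g i (m<n⇒m<1+n i<N))) (f≤g N ≤-refl)

∑<-distrib-+ : ∀ N f g → ∑< N (λ i → f i + g i) ≡ ∑< N f + ∑< N g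
∑<-distrib-+ zero    f g = refl
∑<-distrib-+ (suc N) f g = begin
  ∑< N (λ i → f i + g i) + (f N + g N) ≡⟨ cong (_+ (f N + g N)) (∑<-distrib-+ N f g) ⟩
  ∑< N f + ∑< N g + (f N + g N)       ≡⟨ interchange (∑< N f) (∑< N g) (f N) (g N) ⟩
  ∑< N f + f N + (∑< N g + g N)       ∎

∑<-*-distribˡ : ∀ N c f → ∑< N (λ i → c * f i) ≡ c * ∑< N f
∑<-*-distribˡ zero    c f = sym (*-zeroʳ c)
∑<-*-distribˡ (suc N) c f = trans (cong (_+ c * f N) (∑<-*-distribˡ N c f)) (sym (*-distribˡ-+ c (∑< N f) (f N)))

∑<-zero : ∀ N → ∑< N (λ _ → 0) ≡ 0
∑<-zero zero    = refl
∑<-zero (suc N) = cong (_+ 0) (∑<-zero N)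

∑<-const : ∀ N c → ∑< N (λ _ → c) ≡ N * c
∑<-const zero    c = refl
∑<-const (suc N) c = trans (cong (_+ c) (∑<-const N c)) (+-comm (N * c) c)

∑<-comm : ∀ N M (f : ℕ → ℕ → ℕ) → ∑< N (λ i → ∑< M (f i)) ≡ ∑< M (λ j → ∑< N (λ i → f i j))
∑<-comm zero    M f = sym (∑<-zero M)
∑<-comm (suc N) M f = trans (cong (_+ ∑< M (f N)) (∑<-comm N M f)) (sym (∑<-distrib-+ M _ (f N)))

∑<-+ : ∀ a b f → ∑< (a + b) f ≡ ∑< a f + ∑< b (λ i → f (a + i))
∑<-+ a zero    f = trans (cong (λ N → ∑< N f) (+-identityʳ a)) (sym (+-identityʳ _))
∑<-+ a (suc b) f = begin
  ∑< (a + suc b) f                               ≡⟨ cong (λ N → ∑< N f) (+-suc a b) ⟩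
  ∑< (a + b) f + f (a + b)                       ≡⟨ cong (_+ f (a + b)) (∑<-+ a b f) ⟩
  ∑< a f + ∑< b (λ i → f (a + i)) + f (a + b)   ≡⟨ +-assoc (∑< a f) _ _ ⟩
  ∑< a f + ∑< (suc b) (λ i → f (a + i))         ∎

∑<-suc : ∀ N f → ∑< (suc N) f ≡ f 0 + ∑< N (λ i → f (suc i))
∑<-suc N f = ∑<-+ 1 N f

∑<-reverse : ∀ N f → ∑< N (λ i → f (N ∸ suc i)) ≡ ∑< N f
∑<-reverse zero    f = refl
∑<-reverse (suc N) f = begin
  ∑< N (λ i → f (N ∸ i)) + f (N ∸ N)
    ≡⟨ cong₂ _+_ (∑<-cong N (λ i i<N → cong f (+-∸-assoc 1 i<N))) (cong f (n∸n≡0 N)) ⟩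
  ∑< N (λ i → f (suc (N ∸ suc i))) + f 0   ≡⟨ +-comm _ (f 0) ⟩
  f 0 + ∑< N (λ i → f (suc (N ∸ suc i)))   ≡⟨ cong (f 0 +_) (∑<-reverse N (λ i → f (suc i))) ⟩
  f 0 + ∑< N (λ i → f (suc i))             ≡⟨ sym (∑<-suc N f) ⟩
  ∑< (suc N) f                             ∎

δ : ℕ → ℕ → ℕ
δ s i = 𝟙 (i ≡ᵇ s)

δ-comm : ∀ s i → δ s i ≡ δ i s
δ-comm zero    zero    = refl
δ-comm zero    (suc i) = refl
δ-comm (suc s) zero    = refl
δ-comm (suc s) (suc i) = δ-comm s i

δ-≢ : ∀ {s i} → i ≢ s → δ s i ≡ 0
δ-≢ {zero}  {zero}  i≢s = ⊥-elim (i≢s refl)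
δ-≢ {zero}  {suc i} i≢s = refl
δ-≢ {suc s} {zero}  i≢s = refl
δ-≢ {suc s} {suc i} i≢s = δ-≢ (i≢s ∘′ cong suc)

δ-refl : ∀ s → δ s s ≡ 1
δ-refl zero    = refl
δ-refl (suc s) = δ-refl s

∑<-δ-beyond : ∀ N s (f : ℕ → ℕ) → N ≤ s → ∑< N (λ i → f i * δ s i) ≡ 0
∑<-δ-beyond zero    s f _     = refl
∑<-δ-beyond (suc N) s f N<s = begin
  ∑< N (λ i → f i * δ s i) + f N * δ s N  ≡⟨ cong₂ _+_ (∑<-δ-beyond N s f (<⇒≤ N<s)) (cong (f N *_) (δ-≢ (<⇒≢ N<s))) ⟩
  0 + f N * 0                             ≡⟨ *-zeroʳ (f N) ⟩
  0                                       ∎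

∑<-δ : ∀ N s (f : ℕ → ℕ) → s < N → ∑< N (λ i → f i * δ s i) ≡ f s
∑<-δ (suc N) s f s<1+N with m≤n⇒m<n∨m≡n (s≤s⁻¹ s<1+N)
... | inj₁ s<N = begin
  ∑< N (λ i → f i * δ s i) + f N * δ s N  ≡⟨ cong₂ _+_ (∑<-δ N s f s<N) (cong (f N *_) (δ-≢ (≢-sym (<⇒≢ s<N)))) ⟩
  f s + f N * 0                           ≡⟨ cong (f s +_) (*-zeroʳ (f N)) ⟩
  f s + 0                                 ≡⟨ +-identityʳ (f s) ⟩
  f s                                     ∎
... | inj₂ refl = begin
  ∑< N (λ i → f i * δ N i) + f N * δ N N  ≡⟨ cong₂ _+_ (∑<-δ-beyond N N f ≤-refl) (cong (f N *_) (δ-refl N)) ⟩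
  f N * 1                                 ≡⟨ *-identityʳ (f N) ⟩
  f N                                     ∎

∑<-antitone-subadditive : ∀ K (b : ℕ → ℕ) → (∀ i j → i ≤ j → j < K → b j ≤ b i) →
  ∀ s → s ≤ K → ∑< K b ≤ ∑< s b + ∑< (K ∸ s) b
∑<-antitone-subadditive K b b-anti s s≤K =
  ≤-trans (≤-reflexive split) (+-monoʳ-≤ (∑< s b) (∑<-mono-≤ (K ∸ s) shifted-≤))
  where
  split : ∑< K b ≡ ∑< s b + ∑< (K ∸ s) (λ i → b (s + i))
  split = trans (cong (λ N → ∑< N b) (sym (m+[n∸m]≡n s≤K))) (∑<-+ s (K ∸ s) b)
  shifted-≤ : ∀ i → i < K ∸ s → b (s + i) ≤ b i
  shifted-≤ i i<K∸s = b-anti i (s + i) (m≤n+m i s) (subst (s + i <_) (m+[n∸m]≡n s≤K) (+-monoʳ-< s i<K∸s))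

similarly-ordered-≤ : ∀ {a a' p p'} → a ≤ a' → p ≤ p' → (a + a') * (p + p') ≤ 2 * (a * p + a' * p')
similarly-ordered-≤ {a} {a'} {p} {p'} a≤a' p≤p' with m≤n⇒∃[o]m+o≡n a≤a' | m≤n⇒∃[o]m+o≡n p≤p'
... | u , refl | v , refl = subst ((a + (a + u)) * (p + (p + v)) ≤_) (rearrangement a u p v) (m≤m+n _ (u * v))
  where
  rearrangement : ∀ a u p v → (a + (a + u)) * (p + (p + v)) + u * v ≡ 2 * (a * p + (a + u) * (p + v))
  rearrangement = solve-∀

-- Chebyshev's sum inequality for two increasing sequences, with the mean of a replaced by the
-- bound a K ≤ a s + a (K - s); pairing s with K - s makes both sums symmetric.
chebyshev-≤ : ∀ K (a φ : ℕ → ℕ) →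
  (∀ i j → i ≤ j → j ≤ K → a i ≤ a j) →
  (∀ i j → i ≤ j → j ≤ K → φ i ≤ φ j) →
  (∀ s → s ≤ K → a K ≤ a s + a (K ∸ s)) →
  a K * ∑< (suc K) φ ≤ 2 * ∑< (suc K) (λ s → a s * φ s)
chebyshev-≤ K a φ a-mono φ-mono a-sub =
  *-cancelˡ-≤ 2 (≤-trans (≤-reflexive spread)
                 (≤-trans (∑<-mono-≤ N (λ s s<N → pair-≤ s (s≤s⁻¹ s<N))) (≤-reflexive gather)))
  where
  N = suc K
  aφ : ℕ → ℕ
  aφ s = a s * φ s
  symmetrise : ∀ f → ∑< N (λ s → f s + f (K ∸ s)) ≡ 2 * ∑< N f
  symmetrise f = trans (∑<-distrib-+ N f _) (cong (∑< N f +_) (trans (∑<-reverse N f) (sym (+-identityʳ _))))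
  spread : 2 * (a K * ∑< N φ) ≡ ∑< N (λ s → a K * (φ s + φ (K ∸ s)))
  spread = begin
    2 * (a K * ∑< N φ)                    ≡⟨ *-x∙yz≈y∙xz 2 (a K) _ ⟩
    a K * (2 * ∑< N φ)                    ≡⟨ cong (a K *_) (sym (symmetrise φ)) ⟩
    a K * ∑< N (λ s → φ s + φ (K ∸ s))    ≡⟨ sym (∑<-*-distribˡ N (a K) _) ⟩
    ∑< N (λ s → a K * (φ s + φ (K ∸ s)))  ∎
  gather : ∑< N (λ s → 2 * (aφ s + aφ (K ∸ s))) ≡ 2 * (2 * ∑< N aφ)
  gather = trans (∑<-*-distribˡ N 2 _) (cong (2 *_) (symmetrise aφ))
  ordered-≤ : ∀ i j → i ≤ K → j ≤ K → (a i + a j) * (φ i + φ j) ≤ 2 * (aφ i + aφ j)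
  ordered-≤ i j i≤K j≤K with ≤-total i j
  ... | inj₁ i≤j = similarly-ordered-≤ (a-mono i j i≤j j≤K) (φ-mono i j i≤j j≤K)
  ... | inj₂ j≤i = subst₂ _≤_ (cong₂ _*_ (+-comm (a j) (a i)) (+-comm (φ j) (φ i))) (cong (2 *_) (+-comm (aφ j) (aφ i)))
                     (similarly-ordered-≤ (a-mono j i j≤i i≤K) (φ-mono j i j≤i i≤K))
  pair-≤ : ∀ s → s ≤ K → a K * (φ s + φ (K ∸ s)) ≤ 2 * (aφ s + aφ (K ∸ s))
  pair-≤ s s≤K = ≤-trans (*-monoˡ-≤ _ (a-sub s s≤K)) (ordered-≤ s (K ∸ s) s≤K (m∸n≤m K s))

risingFactorial : ℕ → ℕ → ℕ
risingFactorial t zero    = 1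
risingFactorial t (suc k) = suc (k + t) * risingFactorial t k

k!*[n+k]Ck≡risingFactorial : ∀ k n → k ! * ((n + k) C k) ≡ risingFactorial n k
k!*[n+k]Ck≡risingFactorial zero    n       = refl
k!*[n+k]Ck≡risingFactorial (suc k) zero    = begin
  suc k ! * (suc k C suc k)   ≡⟨ cong (suc k ! *_) (nCn≡1 (suc k)) ⟩
  suc k ! * 1                 ≡⟨ *-identityʳ _ ⟩
  suc k !                     ≡⟨ sym (risingFactorial-0 (suc k)) ⟩
  risingFactorial 0 (suc k)   ∎
  where
  risingFactorial-0 : ∀ k → risingFactorial 0 k ≡ k !
  risingFactorial-0 zero    = refl
  risingFactorial-0 (suc k) = cong₂ _*_ (cong suc (+-identityʳ k)) (risingFactorial-0 k)
k!*[n+k]Ck≡risingFactorial (suc k) (suc n) = begin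
  suc k ! * (suc N C suc k)
    ≡⟨ cong (suc k ! *_) (sym (nCk+nC[k+1]≡[n+1]C[k+1] N k)) ⟩
  suc k ! * (N C k + N C suc k)
    ≡⟨ *-distribˡ-+ (suc k !) (N C k) (N C suc k) ⟩
  suc k ! * (N C k) + suc k ! * (N C suc k)
    ≡⟨ cong₂ _+_ (trans (*-assoc (suc k) (k !) (N C k)) (cong (λ M → suc k * (k ! * (M C k))) (+-suc n k)))
                 (k!*[n+k]Ck≡risingFactorial (suc k) n) ⟩
  suc k * (k ! * ((suc n + k) C k)) + risingFactorial n (suc k)
    ≡⟨ cong₂ _+_ (cong (suc k *_) (k!*[n+k]Ck≡risingFactorial k (suc n))) (risingFactorial-suc n k) ⟩
  suc k * risingFactorial (suc n) k + suc n * risingFactorial (suc n) k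
    ≡⟨ sym (*-distribʳ-+ (risingFactorial (suc n) k) (suc k) (suc n)) ⟩
  (suc k + suc n) * risingFactorial (suc n) k ∎
  where
  N = n + suc k
  risingFactorial-suc : ∀ n k → risingFactorial n (suc k) ≡ suc n * risingFactorial (suc n) k
  risingFactorial-suc n zero    = refl
  risingFactorial-suc n (suc k) = begin
    suc (suc k + n) * risingFactorial n (suc k)             ≡⟨ cong (suc (suc k + n) *_) (risingFactorial-suc n k) ⟩
    suc (suc k + n) * (suc n * risingFactorial (suc n) k)   ≡⟨ *-x∙yz≈y∙xz (suc (suc k + n)) (suc n) (risingFactorial (suc n) k) ⟩
    suc n * (suc (suc k + n) * risingFactorial (suc n) k)   ≡⟨ cong (λ m → suc n * (suc m * risingFactorial (suc n) k)) (sym (+-suc k n)) ⟩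
    suc n * risingFactorial (suc n) (suc k)                 ∎

∑∈ : List A → (A → ℕ) → ℕ
∑∈ []       F = 0
∑∈ (x ∷ xs) F = F x + ∑∈ xs F

∑∈-cong : (xs : List A) {F G : A → ℕ} → (∀ x → F x ≡ G x) → ∑∈ xs F ≡ ∑∈ xs G
∑∈-cong []       F≡G = refl
∑∈-cong (x ∷ xs) F≡G = cong₂ _+_ (F≡G x) (∑∈-cong xs F≡G)

∑∈-zero : (xs : List A) {F : A → ℕ} → (∀ x → F x ≡ 0) → ∑∈ xs F ≡ 0
∑∈-zero []       F≡0 = refl
∑∈-zero (x ∷ xs) F≡0 = cong₂ _+_ (F≡0 x) (∑∈-zero xs F≡0)

∑∈-distrib-+ : (xs : List A) (F G : A → ℕ) → ∑∈ xs (λ x → F x + G x) ≡ ∑∈ xs F + ∑∈ xs G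
∑∈-distrib-+ []       F G = refl
∑∈-distrib-+ (x ∷ xs) F G =
  trans (cong (F x + G x +_) (∑∈-distrib-+ xs F G)) (interchange (F x) (G x) (∑∈ xs F) (∑∈ xs G))

∑∈-++ : (xs ys : List A) (F : A → ℕ) → ∑∈ (xs ++ ys) F ≡ ∑∈ xs F + ∑∈ ys F
∑∈-++ []       ys F = refl
∑∈-++ (x ∷ xs) ys F = trans (cong (F x +_) (∑∈-++ xs ys F)) (sym (+-assoc (F x) _ _))

∑∈-*-distribˡ : (xs : List A) (c : ℕ) (F : A → ℕ) → ∑∈ xs (λ x → c * F x) ≡ c * ∑∈ xs F
∑∈-*-distribˡ []       c F = sym (*-zeroʳ c)
∑∈-*-distribˡ (x ∷ xs) c F = trans (cong (c * F x +_) (∑∈-*-distribˡ xs c F)) (sym (*-distribˡ-+ c (F x) _))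

∑∈-*-distribʳ : (xs : List A) (c : ℕ) (F : A → ℕ) → ∑∈ xs (λ x → F x * c) ≡ ∑∈ xs F * c
∑∈-*-distribʳ xs c F = begin
  ∑∈ xs (λ x → F x * c) ≡⟨ ∑∈-cong xs (λ x → *-comm (F x) c) ⟩
  ∑∈ xs (λ x → c * F x) ≡⟨ ∑∈-*-distribˡ xs c F ⟩
  c * ∑∈ xs F           ≡⟨ *-comm c _ ⟩
  ∑∈ xs F * c           ∎

∑∈-∑< : (xs : List A) (N : ℕ) (F : A → ℕ → ℕ) →
  ∑∈ xs (λ x → ∑< N (F x)) ≡ ∑< N (λ i → ∑∈ xs (λ x → F x i))
∑∈-∑< []       N F = sym (∑<-zero N)
∑∈-∑< (x ∷ xs) N F = trans (cong (∑< N (F x) +_) (∑∈-∑< xs N F)) (sym (∑<-distrib-+ N (F x) _))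

∑∈-filterᵇ : (R : A → Bool) (xs : List A) (F : A → ℕ) → ∑∈ xs (λ x → 𝟙 (R x) * F x) ≡ ∑∈ (filterᵇ R xs) F
∑∈-filterᵇ R []       F = refl
∑∈-filterᵇ R (x ∷ xs) F with R x
... | true  = cong₂ _+_ (+-identityʳ (F x)) (∑∈-filterᵇ R xs F)
... | false = ∑∈-filterᵇ R xs F

∑∈-map : (h : A → B) (xs : List A) (F : B → ℕ) → ∑∈ (map h xs) F ≡ ∑∈ xs (λ x → F (h x))
∑∈-map h []       F = refl
∑∈-map h (x ∷ xs) F = cong (F (h x) +_) (∑∈-map h xs F)

∑∈-concatMap : (g : A → List B) (xs : List A) (F : B → ℕ) → ∑∈ (concatMap g xs) F ≡ ∑∈ xs (λ x → ∑∈ (g x) F)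
∑∈-concatMap g []       F = refl
∑∈-concatMap g (x ∷ xs) F = trans (∑∈-++ (g x) _ F) (cong (∑∈ (g x) F +_) (∑∈-concatMap g xs F))

∑∈-comm : (xs : List A) (ys : List B) (F : A → B → ℕ) →
  ∑∈ xs (λ x → ∑∈ ys (F x)) ≡ ∑∈ ys (λ y → ∑∈ xs (λ x → F x y))
∑∈-comm []       ys F = sym (∑∈-zero ys (λ _ → refl))
∑∈-comm (x ∷ xs) ys F = trans (cong (∑∈ ys (F x) +_) (∑∈-comm xs ys F)) (sym (∑∈-distrib-+ ys (F x) _))

∑∈-allVecs-∷ : (L : List A) (m : ℕ) (F : Vec A (suc m) → ℕ) →
  ∑∈ (allVecs L (suc m)) F ≡ ∑∈ L (λ x → ∑∈ (allVecs L m) (λ v → F (x ∷ v)))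
∑∈-allVecs-∷ L m F = trans (∑∈-concatMap _ L F) (∑∈-cong L (λ x → ∑∈-map (x ∷_) (allVecs L m) F))

∑∈-allVecs-∷ʳ : (L : List A) (m : ℕ) (F : Vec A (suc m) → ℕ) →
  ∑∈ (allVecs L (suc m)) F ≡ ∑∈ L (λ x → ∑∈ (allVecs L m) (λ v → F (v Vec.∷ʳ x)))
∑∈-allVecs-∷ʳ L zero    F = ∑∈-allVecs-∷ L zero F
∑∈-allVecs-∷ʳ L (suc m) F = begin
  ∑∈ (allVecs L (suc (suc m))) F
    ≡⟨ ∑∈-allVecs-∷ L (suc m) F ⟩
  ∑∈ L (λ y → ∑∈ (allVecs L (suc m)) (λ u → F (y ∷ u)))
    ≡⟨ ∑∈-cong L (λ y → ∑∈-allVecs-∷ʳ L m (λ u → F (y ∷ u))) ⟩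
  ∑∈ L (λ y → ∑∈ L (λ x → ∑∈ (allVecs L m) (λ v → F ((y ∷ v) Vec.∷ʳ x))))
    ≡⟨ ∑∈-comm L L _ ⟩
  ∑∈ L (λ x → ∑∈ L (λ y → ∑∈ (allVecs L m) (λ v → F ((y ∷ v) Vec.∷ʳ x))))
    ≡⟨ ∑∈-cong L (λ x → sym (∑∈-allVecs-∷ L m (λ u → F (u Vec.∷ʳ x)))) ⟩
  ∑∈ L (λ x → ∑∈ (allVecs L (suc m)) (λ u → F (u Vec.∷ʳ x))) ∎

∑∈-allVecs-reverse : (L : List A) (m : ℕ) (F : Vec A m → ℕ) →
  ∑∈ (allVecs L m) (λ v → F (Vec.reverse v)) ≡ ∑∈ (allVecs L m) F
∑∈-allVecs-reverse L zero    F = refl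
∑∈-allVecs-reverse L (suc m) F = begin
  ∑∈ (allVecs L (suc m)) (λ v → F (Vec.reverse v))
    ≡⟨ ∑∈-allVecs-∷ L m _ ⟩
  ∑∈ L (λ x → ∑∈ (allVecs L m) (λ v → F (Vec.reverse (x ∷ v))))
    ≡⟨ ∑∈-cong L (λ x → ∑∈-cong (allVecs L m) (λ v → cong F (VecP.reverse-∷ x v))) ⟩
  ∑∈ L (λ x → ∑∈ (allVecs L m) (λ v → F (Vec.reverse v Vec.∷ʳ x)))
    ≡⟨ ∑∈-cong L (λ x → ∑∈-allVecs-reverse L m (λ v → F (v Vec.∷ʳ x))) ⟩
  ∑∈ L (λ x → ∑∈ (allVecs L m) (λ v → F (v Vec.∷ʳ x)))
    ≡⟨ sym (∑∈-allVecs-∷ʳ L m F) ⟩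
  ∑∈ (allVecs L (suc m)) F ∎

∑∈-allVecs-map : (f : A → B) (L : List A) (m : ℕ) (F : Vec B m → ℕ) →
  ∑∈ (allVecs (map f L) m) F ≡ ∑∈ (allVecs L m) (λ v → F (Vec.map f v))
∑∈-allVecs-map f L zero    F = refl
∑∈-allVecs-map f L (suc m) F = begin
  ∑∈ (allVecs (map f L) (suc m)) F
    ≡⟨ ∑∈-allVecs-∷ (map f L) m F ⟩
  ∑∈ (map f L) (λ y → ∑∈ (allVecs (map f L) m) (λ v → F (y ∷ v)))
    ≡⟨ ∑∈-map f L _ ⟩
  ∑∈ L (λ x → ∑∈ (allVecs (map f L) m) (λ v → F (f x ∷ v)))
    ≡⟨ ∑∈-cong L (λ x → ∑∈-allVecs-map f L m (λ v → F (f x ∷ v))) ⟩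
  ∑∈ L (λ x → ∑∈ (allVecs L m) (λ v → F (f x ∷ Vec.map f v)))
    ≡⟨ sym (∑∈-allVecs-∷ L m _) ⟩
  ∑∈ (allVecs L (suc m)) (λ v → F (Vec.map f v)) ∎

∑∈-allVecs-filterᵇ : (R : A → Bool) (L : List A) (m : ℕ) (F : Vec A m → ℕ) →
  ∑∈ (allVecs L m) (λ v → 𝟙 (all R (toList v)) * F v) ≡ ∑∈ (allVecs (filterᵇ R L) m) F
∑∈-allVecs-filterᵇ R L zero    F = cong (_+ 0) (+-identityʳ (F []))
∑∈-allVecs-filterᵇ R L (suc m) F = begin
  ∑∈ (allVecs L (suc m)) (λ v → 𝟙 (all R (toList v)) * F v)
    ≡⟨ ∑∈-allVecs-∷ L m _ ⟩
  ∑∈ L (λ x → ∑∈ (allVecs L m) (λ v → 𝟙 (R x ∧ all R (toList v)) * F (x ∷ v)))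
    ≡⟨ ∑∈-cong L (λ x → ∑∈-cong (allVecs L m) (λ v →
         trans (cong (_* F (x ∷ v)) (𝟙-∧ (R x) _)) (*-assoc (𝟙 (R x)) _ (F (x ∷ v))))) ⟩
  ∑∈ L (λ x → ∑∈ (allVecs L m) (λ v → 𝟙 (R x) * (𝟙 (all R (toList v)) * F (x ∷ v))))
    ≡⟨ ∑∈-cong L (λ x → ∑∈-*-distribˡ (allVecs L m) (𝟙 (R x)) _) ⟩
  ∑∈ L (λ x → 𝟙 (R x) * ∑∈ (allVecs L m) (λ v → 𝟙 (all R (toList v)) * F (x ∷ v)))
    ≡⟨ ∑∈-cong L (λ x → cong (𝟙 (R x) *_) (∑∈-allVecs-filterᵇ R L m (λ v → F (x ∷ v)))) ⟩
  ∑∈ L (λ x → 𝟙 (R x) * ∑∈ (allVecs (filterᵇ R L) m) (λ v → F (x ∷ v)))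
    ≡⟨ ∑∈-filterᵇ R L _ ⟩
  ∑∈ (filterᵇ R L) (λ x → ∑∈ (allVecs (filterᵇ R L) m) (λ v → F (x ∷ v)))
    ≡⟨ sym (∑∈-allVecs-∷ (filterᵇ R L) m F) ⟩
  ∑∈ (allVecs (filterᵇ R L) (suc m)) F ∎

length-filter : {P : A → Set} (P? : (x : A) → Dec (P x)) (xs : List A) →
  length (filter P? xs) ≡ ∑∈ xs (λ x → 𝟙 (does (P? x)))
length-filter P? []       = refl
length-filter P? (x ∷ xs) with does (P? x)
... | true  = cong suc (length-filter P? xs)
... | false = length-filter P? xs

does-all? : {P : A → Set} (P? : (x : A) → Dec (P x)) (xs : List A) → does (All.all? P? xs) ≡ all (λ x → does (P? x)) xs
does-all? P? []       = refl
does-all? P? (x ∷ xs) = cong (does (P? x) ∧_) (does-all? P? xs)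

-- Binary words

map-not-involutive : ∀ (u : List Bool) → map not (map not u) ≡ u
map-not-involutive []      = refl
map-not-involutive (x ∷ u) = cong₂ _∷_ (BoolP.not-involutive x) (map-not-involutive u)

allWords : ℕ → List (List Bool)
allWords k = map toList (allVecs (true ∷ false ∷ []) k)

∑∈-allWords-suc : ∀ k (F : List Bool → ℕ) →
  ∑∈ (allWords (suc k)) F ≡ ∑∈ (allWords k) (λ p → F (true ∷ p) + F (false ∷ p))
∑∈-allWords-suc k F = begin
  ∑∈ (allWords (suc k)) F
    ≡⟨ ∑∈-map toList (allVecs bits (suc k)) F ⟩
  ∑∈ (allVecs bits (suc k)) (λ v → F (toList v))
    ≡⟨ ∑∈-allVecs-∷ bits k _ ⟩
  ∑∈ (allVecs bits k) (λ v → F (true ∷ toList v)) + (∑∈ (allVecs bits k) (λ v → F (false ∷ toList v)) + 0)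
    ≡⟨ cong (∑∈ (allVecs bits k) (λ v → F (true ∷ toList v)) +_) (+-identityʳ _) ⟩
  ∑∈ (allVecs bits k) (λ v → F (true ∷ toList v)) + ∑∈ (allVecs bits k) (λ v → F (false ∷ toList v))
    ≡⟨ sym (∑∈-distrib-+ (allVecs bits k) _ _) ⟩
  ∑∈ (allVecs bits k) (λ v → F (true ∷ toList v) + F (false ∷ toList v))
    ≡⟨ sym (∑∈-map toList (allVecs bits k) _) ⟩
  ∑∈ (allWords k) (λ p → F (true ∷ p) + F (false ∷ p)) ∎
  where bits = true ∷ false ∷ []

∑∈-allWords-cong : ∀ k {F G : List Bool → ℕ} → (∀ p → length p ≡ k → F p ≡ G p) →
  ∑∈ (allWords k) F ≡ ∑∈ (allWords k) G
∑∈-allWords-cong k {F} {G} F≡G = begin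
  ∑∈ (allWords k) F                                        ≡⟨ ∑∈-map toList (allVecs _ k) F ⟩
  ∑∈ (allVecs (true ∷ false ∷ []) k) (λ v → F (toList v))  ≡⟨ ∑∈-cong (allVecs _ k) (λ v → F≡G (toList v) (VecP.length-toList v)) ⟩
  ∑∈ (allVecs (true ∷ false ∷ []) k) (λ v → G (toList v))  ≡⟨ sym (∑∈-map toList (allVecs _ k) G) ⟩
  ∑∈ (allWords k) G                                        ∎

∑∈-allWords-reverse : ∀ k (F : List Bool → ℕ) → ∑∈ (allWords k) (λ p → F (reverse p)) ≡ ∑∈ (allWords k) F
∑∈-allWords-reverse k F = begin
  ∑∈ (allWords k) (λ p → F (reverse p))
    ≡⟨ ∑∈-map toList (allVecs bits k) _ ⟩
  ∑∈ (allVecs bits k) (λ v → F (reverse (toList v)))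
    ≡⟨ ∑∈-cong (allVecs bits k) (λ v → cong F (sym (VecP.toList-reverse v))) ⟩
  ∑∈ (allVecs bits k) (λ v → F (toList (Vec.reverse v)))
    ≡⟨ ∑∈-allVecs-reverse bits k (λ v → F (toList v)) ⟩
  ∑∈ (allVecs bits k) (λ v → F (toList v))
    ≡⟨ sym (∑∈-map toList (allVecs bits k) F) ⟩
  ∑∈ (allWords k) F ∎
  where bits = true ∷ false ∷ []

∑∈-allVecs-not : ∀ k (H : Vec Bool k → ℕ) →
  ∑∈ (allVecs (true ∷ false ∷ []) k) (λ v → H (Vec.map not v)) ≡ ∑∈ (allVecs (true ∷ false ∷ []) k) H
∑∈-allVecs-not zero    H = refl
∑∈-allVecs-not (suc k) H = begin
  ∑∈ (allVecs bits (suc k)) (λ v → H (Vec.map not v))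
    ≡⟨ ∑∈-allVecs-∷ bits k _ ⟩
  ∑∈ bits (λ x → ∑∈ (allVecs bits k) (λ v → H (not x ∷ Vec.map not v)))
    ≡⟨ ∑∈-cong bits (λ x → ∑∈-allVecs-not k (λ v → H (not x ∷ v))) ⟩
  ∑∈ bits (λ x → ∑∈ (allVecs bits k) (λ v → H (not x ∷ v)))
    ≡⟨ +-x∙yz≈y∙xz (startingWith false) (startingWith true) 0 ⟩
  ∑∈ bits (λ x → ∑∈ (allVecs bits k) (λ v → H (x ∷ v)))
    ≡⟨ sym (∑∈-allVecs-∷ bits k H) ⟩
  ∑∈ (allVecs bits (suc k)) H ∎
  where
  bits = true ∷ false ∷ []
  startingWith : Bool → ℕ
  startingWith x = ∑∈ (allVecs bits k) (λ v → H (x ∷ v))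

∑∈-allWords-not : ∀ k (F : List Bool → ℕ) → ∑∈ (allWords k) (λ p → F (map not p)) ≡ ∑∈ (allWords k) F
∑∈-allWords-not k F = begin
  ∑∈ (allWords k) (λ p → F (map not p))
    ≡⟨ ∑∈-map toList (allVecs bits k) _ ⟩
  ∑∈ (allVecs bits k) (λ v → F (map not (toList v)))
    ≡⟨ ∑∈-cong (allVecs bits k) (λ v → cong F (sym (VecP.toList-map not v))) ⟩
  ∑∈ (allVecs bits k) (λ v → F (toList (Vec.map not v)))
    ≡⟨ ∑∈-allVecs-not k (λ v → F (toList v)) ⟩
  ∑∈ (allVecs bits k) (λ v → F (toList v))
    ≡⟨ sym (∑∈-map toList (allVecs bits k) F) ⟩
  ∑∈ (allWords k) F ∎
  where bits = true ∷ false ∷ []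

reverseComplement : List Bool → List Bool
reverseComplement u = map not (reverse u)

reverseComplement-∷ : ∀ b u → reverseComplement (b ∷ u) ≡ reverseComplement u ∷ʳ not b
reverseComplement-∷ b u = trans (cong (map not) (ListP.unfold-reverse b u)) (ListP.map-++ not (reverse u) (b ∷ []))

reverseComplement-involutive : ∀ u → reverseComplement (reverseComplement u) ≡ u
reverseComplement-involutive u = begin
  map not (reverse (map not (reverse u)))   ≡⟨ cong (map not) (sym (ListP.reverse-map not (reverse u))) ⟩
  map not (map not (reverse (reverse u)))   ≡⟨ map-not-involutive _ ⟩
  reverse (reverse u)                       ≡⟨ ListP.reverse-involutive u ⟩
  u                                         ∎

reverseComplement-++ : ∀ u v → reverseComplement (u ++ v) ≡ reverseComplement v ++ reverseComplement u
reverseComplement-++ u v = trans (cong (map not) (ListP.reverse-++ u v)) (ListP.map-++ not (reverse v) (reverse u))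

length-reverseComplement : ∀ u → length (reverseComplement u) ≡ length u
length-reverseComplement u = trans (ListP.length-map not (reverse u)) (ListP.length-reverse u)

∑∈-allWords-reverseComplement : ∀ k (F : List Bool → ℕ) →
  ∑∈ (allWords k) (λ p → F (reverseComplement p)) ≡ ∑∈ (allWords k) F
∑∈-allWords-reverseComplement k F =
  trans (∑∈-allWords-reverse k (λ p → F (map not p))) (∑∈-allWords-not k F)

alt-suc : ∀ j → alt (suc j) ≡ true ∷ map not (alt j)
alt-suc zero    = refl
alt-suc (suc j) = cong (true ∷_) (begin
  false ∷ alt j                        ≡⟨ cong (false ∷_) (sym (map-not-involutive (alt j))) ⟩
  map not (true ∷ map not (alt j))     ≡⟨ cong (map not) (sym (alt-suc j)) ⟩
  map not (alt (suc j))                ∎)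

map-not-alt-suc : ∀ j → map not (alt (suc j)) ≡ false ∷ alt j
map-not-alt-suc j = trans (cong (map not) (alt-suc j)) (cong (false ∷_) (map-not-involutive (alt j)))

-- Counting permutations by their first entry

letterWeight : Bool → ℕ → ℕ → ℕ
letterWeight x s j = 𝟙 (does ((s <ᵇ j) Bool.≟ x))

letterWeight≤1 : ∀ x s j → letterWeight x s j ≤ 1
letterWeight≤1 x s j = 𝟙≤1 (does ((s <ᵇ j) Bool.≟ x))

letterWeight-true+false : ∀ s j → letterWeight true s j + letterWeight false s j ≡ 1
letterWeight-true+false s j with s <ᵇ j
... | true  = refl
... | false = refl

transfer : Bool → ℕ → (ℕ → ℕ) → ℕ → ℕ
transfer x t g j = ∑< t (λ s → letterWeight x s j * g s)

-- After deleting the first entry j and standardising, the next entry has some rank s, and it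
-- lies below j exactly when s < j.
firstCount : ℕ → List Bool → ℕ → ℕ
firstCount zero    []      j = δ 0 j
firstCount zero    (_ ∷ _) j = 0
firstCount (suc m) []      j = 0
firstCount (suc m) (x ∷ u) j = transfer x (suc m) (firstCount m u) j

transferWord : List Bool → ℕ → (ℕ → ℕ) → ℕ → ℕ
transferWord []      t f = f
transferWord (x ∷ w) t f = transfer x (length w + t) (transferWord w t f)

transfer-cong : ∀ x t {f g} → (∀ i → i < t → f i ≡ g i) → ∀ j → transfer x t f j ≡ transfer x t g j
transfer-cong x t f≡g j = ∑<-cong t (λ i i<t → cong (letterWeight x i j *_) (f≡g i i<t))

transfer-true+false : ∀ t g j → transfer true t g j + transfer false t g j ≡ ∑< t g
transfer-true+false t g j = begin
  transfer true t g j + transfer false t g j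
    ≡⟨ sym (∑<-distrib-+ t _ _) ⟩
  ∑< t (λ s → letterWeight true s j * g s + letterWeight false s j * g s)
    ≡⟨ ∑<-cong t (λ s _ → sym (*-distribʳ-+ (g s) (letterWeight true s j) (letterWeight false s j))) ⟩
  ∑< t (λ s → (letterWeight true s j + letterWeight false s j) * g s)
    ≡⟨ ∑<-cong t (λ s _ → trans (cong (_* g s) (letterWeight-true+false s j)) (*-identityˡ (g s))) ⟩
  ∑< t g ∎

firstCount-++ : ∀ w m v j → firstCount (length w + m) (w ++ v) j ≡ transferWord w (suc m) (firstCount m v) j
firstCount-++ []      m v j = refl
firstCount-++ (x ∷ w) m v j = begin
  transfer x (suc (length w + m)) (firstCount (length w + m) (w ++ v)) j
    ≡⟨ cong (λ t → transfer x t (firstCount (length w + m) (w ++ v)) j) (sym (+-suc (length w) m)) ⟩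
  transfer x (length w + suc m) (firstCount (length w + m) (w ++ v)) j
    ≡⟨ transfer-cong x (length w + suc m) (λ i _ → firstCount-++ w m v i) j ⟩
  transfer x (length w + suc m) (transferWord w (suc m) (firstCount m v)) j ∎

transferWord-++ : ∀ w v t f j → transferWord (w ++ v) t f j ≡ transferWord w (length v + t) (transferWord v t f) j
transferWord-++ []      v t f j = refl
transferWord-++ (x ∷ w) v t f j = begin
  transfer x (length (w ++ v) + t) (transferWord (w ++ v) t f) j
    ≡⟨ cong (λ N → transfer x N (transferWord (w ++ v) t f) j)
         (trans (cong (_+ t) (ListP.length-++ w)) (+-assoc (length w) (length v) t)) ⟩
  transfer x (length w + (length v + t)) (transferWord (w ++ v) t f) j
    ≡⟨ transfer-cong x (length w + (length v + t)) (λ i _ → transferWord-++ w v t f i) j ⟩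
  transfer x (length w + (length v + t)) (transferWord w (length v + t) (transferWord v t f)) j ∎

transferWord-mono-≤ : ∀ w t {f g} → (∀ i → f i ≤ g i) → ∀ j → transferWord w t f j ≤ transferWord w t g j
transferWord-mono-≤ []      t f≤g j = f≤g j
transferWord-mono-≤ (x ∷ w) t f≤g j =
  ∑<-mono-≤ (length w + t) (λ i _ → *-monoʳ-≤ (letterWeight x i j) (transferWord-mono-≤ w t f≤g i))

transferWord-linear : ∀ w t f j → j < length w + t →
  transferWord w t f j ≡ ∑< t (λ s → f s * transferWord w t (δ s) j)
transferWord-linear []      t f j j<t =
  sym (trans (∑<-cong t (λ s _ → cong (f s *_) (δ-comm s j))) (∑<-δ t j f j<t))
transferWord-linear (x ∷ w) t f j _ = begin
  ∑< L (λ s → letterWeight x s j * transferWord w t f s)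
    ≡⟨ ∑<-cong L (λ s s<L → cong (letterWeight x s j *_) (transferWord-linear w t f s s<L)) ⟩
  ∑< L (λ s → letterWeight x s j * ∑< t (λ r → f r * transferWord w t (δ r) s))
    ≡⟨ ∑<-cong L (λ s _ → trans (sym (∑<-*-distribˡ t (letterWeight x s j) _))
          (∑<-cong t (λ r _ → *-x∙yz≈y∙xz (letterWeight x s j) (f r) _))) ⟩
  ∑< L (λ s → ∑< t (λ r → f r * (letterWeight x s j * transferWord w t (δ r) s)))
    ≡⟨ ∑<-comm L t _ ⟩
  ∑< t (λ r → ∑< L (λ s → f r * (letterWeight x s j * transferWord w t (δ r) s)))
    ≡⟨ ∑<-cong t (λ r _ → ∑<-*-distribˡ L (f r) _) ⟩
  ∑< t (λ r → f r * ∑< L (λ s → letterWeight x s j * transferWord w t (δ r) s)) ∎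
  where L = length w + t

-- prefixWeight w t s counts the ways to put entries with descent word w in front of a block
-- of t entries whose first entry has rank s within the block.
prefixWeight : List Bool → ℕ → ℕ → ℕ
prefixWeight w t s = ∑< (length w + t) (transferWord w t (δ s))

∑<-transferWord : ∀ w t f → ∑< (length w + t) (transferWord w t f) ≡ ∑< t (λ s → f s * prefixWeight w t s)
∑<-transferWord w t f = begin
  ∑< L (transferWord w t f)
    ≡⟨ ∑<-cong L (λ j j<L → transferWord-linear w t f j j<L) ⟩
  ∑< L (λ j → ∑< t (λ s → f s * transferWord w t (δ s) j))
    ≡⟨ ∑<-comm L t _ ⟩
  ∑< t (λ s → ∑< L (λ j → f s * transferWord w t (δ s) j))
    ≡⟨ ∑<-cong t (λ s _ → ∑<-*-distribˡ L (f s) _) ⟩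
  ∑< t (λ s → f s * prefixWeight w t s) ∎
  where L = length w + t

letterWeight-false-monoˡ-≤ : ∀ {s s'} j → s ≤ s' → letterWeight false s j ≤ letterWeight false s' j
letterWeight-false-monoˡ-≤ {s} {s'} j s≤s' with s' <? j
... | yes s'<j rewrite <⇒<ᵇ≡true (≤-<-trans s≤s' s'<j) = z≤n
... | no  s'≮j rewrite ≥⇒<ᵇ≡false {s'} {j} (≮⇒≥ s'≮j) = letterWeight≤1 false s j

letterWeight-false-antiʳ-≤ : ∀ {j j'} s → j ≤ j' → letterWeight false s j' ≤ letterWeight false s j
letterWeight-false-antiʳ-≤ {j} {j'} s j≤j' with s <? j
... | yes s<j rewrite <⇒<ᵇ≡true (<-≤-trans s<j j≤j') = z≤n
... | no  s≮j rewrite ≥⇒<ᵇ≡false {s} {j} (≮⇒≥ s≮j) = letterWeight≤1 false s j'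

letterWeight-true-monoʳ-≤ : ∀ {j j'} s → j ≤ j' → letterWeight true s j ≤ letterWeight true s j'
letterWeight-true-monoʳ-≤ {j} {j'} s j≤j' with s <? j
... | yes s<j rewrite <⇒<ᵇ≡true (<-≤-trans s<j j≤j') = letterWeight≤1 true s j
... | no  s≮j rewrite ≥⇒<ᵇ≡false {s} {j} (≮⇒≥ s≮j) = z≤n

prefixWeight-mono-≤ : ∀ w t {s s'} → s ≤ s' → s' < t →
  prefixWeight (w ++ false ∷ []) t s ≤ prefixWeight (w ++ false ∷ []) t s'
prefixWeight-mono-≤ w t {s} {s'} s≤s' s'<t = ∑<-mono-≤ (length (w ++ false ∷ []) + t) (λ j _ →
  subst₂ _≤_ (sym (transferWord-++ w (false ∷ []) t (δ s) j)) (sym (transferWord-++ w (false ∷ []) t (δ s') j))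
    (transferWord-mono-≤ w (suc t) (λ i →
      subst₂ _≤_ (sym (∑<-δ t s (λ r → letterWeight false r i) (≤-<-trans s≤s' s'<t)))
                 (sym (∑<-δ t s' (λ r → letterWeight false r i) s'<t))
                 (letterWeight-false-monoˡ-≤ i s≤s')) j))

-- Without constraints on the prefix, each letter multiplies the total by the current size.
∑∈-allWords-transferWord : ∀ k t f →
  ∑∈ (allWords k) (λ p → ∑< (length p + t) (transferWord p t f)) ≡ risingFactorial t k * ∑< t f
∑∈-allWords-transferWord zero    t f = trans (+-identityʳ _) (sym (+-identityʳ _))
∑∈-allWords-transferWord (suc k) t f = begin
  ∑∈ (allWords (suc k)) (λ p → ∑< (length p + t) (transferWord p t f))
    ≡⟨ ∑∈-allWords-suc k _ ⟩
  ∑∈ (allWords k) (λ p → ∑< (suc (length p + t)) (transfer true (length p + t) (transferWord p t f))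
                       + ∑< (suc (length p + t)) (transfer false (length p + t) (transferWord p t f)))
    ≡⟨ ∑∈-allWords-cong k (λ p ∣p∣≡k → letter-free p ∣p∣≡k) ⟩
  ∑∈ (allWords k) (λ p → suc (k + t) * ∑< (length p + t) (transferWord p t f))
    ≡⟨ ∑∈-*-distribˡ (allWords k) (suc (k + t)) _ ⟩
  suc (k + t) * ∑∈ (allWords k) (λ p → ∑< (length p + t) (transferWord p t f))
    ≡⟨ cong (suc (k + t) *_) (∑∈-allWords-transferWord k t f) ⟩
  suc (k + t) * (risingFactorial t k * ∑< t f)
    ≡⟨ sym (*-assoc (suc (k + t)) (risingFactorial t k) _) ⟩
  risingFactorial t (suc k) * ∑< t f ∎
  where
  letter-free : ∀ p → length p ≡ k →
    ∑< (suc (length p + t)) (transfer true (length p + t) (transferWord p t f))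
      + ∑< (suc (length p + t)) (transfer false (length p + t) (transferWord p t f))
    ≡ suc (k + t) * ∑< (length p + t) (transferWord p t f)
  letter-free p refl = begin
    ∑< N (transfer true L g) + ∑< N (transfer false L g) ≡⟨ sym (∑<-distrib-+ N _ _) ⟩
    ∑< N (λ j → transfer true L g j + transfer false L g j) ≡⟨ ∑<-cong N (λ j _ → transfer-true+false L g j) ⟩
    ∑< N (λ _ → ∑< L g)                                   ≡⟨ ∑<-const N (∑< L g) ⟩
    N * ∑< L g                                            ∎
    where
    L = length p + t
    N = suc L
    g = transferWord p t f

∑∈-allWords-firstCount : ∀ k j → j ≤ k → ∑∈ (allWords k) (λ p → firstCount k p j) ≡ k !
∑∈-allWords-firstCount zero    zero _ = refl
∑∈-allWords-firstCount (suc k) j _    = begin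
  ∑∈ (allWords (suc k)) (λ p → firstCount (suc k) p j)
    ≡⟨ ∑∈-allWords-suc k _ ⟩
  ∑∈ (allWords k) (λ p → transfer true (suc k) (firstCount k p) j + transfer false (suc k) (firstCount k p) j)
    ≡⟨ ∑∈-cong (allWords k) (λ p → transfer-true+false (suc k) (firstCount k p) j) ⟩
  ∑∈ (allWords k) (λ p → ∑< (suc k) (firstCount k p))
    ≡⟨ ∑∈-∑< (allWords k) (suc k) (firstCount k) ⟩
  ∑< (suc k) (λ s → ∑∈ (allWords k) (λ p → firstCount k p s))
    ≡⟨ ∑<-cong (suc k) (λ s s<1+k → ∑∈-allWords-firstCount k s (s≤s⁻¹ s<1+k)) ⟩
  ∑< (suc k) (λ _ → k !)
    ≡⟨ ∑<-const (suc k) (k !) ⟩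
  suc k ! ∎

firstCount-zeros : ∀ k j → firstCount k (zeros k) j ≡ δ 0 j
firstCount-zeros zero    j = refl
firstCount-zeros (suc k) j = begin
  ∑< (suc k) (λ s → letterWeight false s j * firstCount k (zeros k) s)
    ≡⟨ ∑<-cong (suc k) (λ s _ → cong (letterWeight false s j *_) (firstCount-zeros k s)) ⟩
  ∑< (suc k) (λ s → letterWeight false s j * δ 0 s)
    ≡⟨ ∑<-δ (suc k) 0 (λ s → letterWeight false s j) (s≤s z≤n) ⟩
  letterWeight false 0 j
    ≡⟨ first-is-minimum j ⟩
  δ 0 j ∎
  where
  first-is-minimum : ∀ j → letterWeight false 0 j ≡ δ 0 j
  first-is-minimum zero    = refl
  first-is-minimum (suc j) = refl

-- Complementing values (s ↦ m - s, j ↦ m + 1 - j) swaps ascents and descents.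
letterWeight-not : ∀ x m s j → s ≤ m → j ≤ suc m → letterWeight (not x) (m ∸ s) j ≡ letterWeight x s (suc m ∸ j)
letterWeight-not x m s j s≤m j≤1+m = cong 𝟙 (begin
  does (((m ∸ s) <ᵇ j) Bool.≟ not x)        ≡⟨ cong (λ b → does (b Bool.≟ not x)) below-complement ⟩
  does (not (s <ᵇ (suc m ∸ j)) Bool.≟ not x) ≡⟨ not-≟-not (s <ᵇ (suc m ∸ j)) x ⟩
  does ((s <ᵇ (suc m ∸ j)) Bool.≟ x)        ∎)
  where
  below-complement : ((m ∸ s) <ᵇ j) ≡ not (s <ᵇ (suc m ∸ j))
  below-complement = begin
    (m ∸ s) <ᵇ j                     ≡⟨ m<ᵇn≡not[n<ᵇ1+m] (m ∸ s) j ⟩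
    not (j <ᵇ suc (m ∸ s))           ≡⟨ cong not (sym (+-cancelˡ-<ᵇ s j (suc (m ∸ s)))) ⟩
    not (s + j <ᵇ s + suc (m ∸ s))   ≡⟨ cong (λ n → not (s + j <ᵇ n)) (trans (+-suc s (m ∸ s)) (cong suc (m+[n∸m]≡n s≤m))) ⟩
    not (s + j <ᵇ suc m)             ≡⟨ cong not (sym (<ᵇ-∸ʳ s (suc m) j j≤1+m)) ⟩
    not (s <ᵇ (suc m ∸ j))           ∎

firstCount-not : ∀ m u j → j ≤ m → firstCount m (map not u) j ≡ firstCount m u (m ∸ j)
firstCount-not zero    []      zero _      = refl
firstCount-not zero    (x ∷ u) j    _      = refl
firstCount-not (suc m) []      j    _      = refl
firstCount-not (suc m) (x ∷ u) j    j≤1+m = begin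
  ∑< (suc m) (λ s → letterWeight (not x) s j * firstCount m (map not u) s)
    ≡⟨ ∑<-cong (suc m) (λ s s<1+m → cong (letterWeight (not x) s j *_) (firstCount-not m u s (s≤s⁻¹ s<1+m))) ⟩
  ∑< (suc m) (λ s → letterWeight (not x) s j * firstCount m u (m ∸ s))
    ≡⟨ ∑<-cong (suc m) (λ s s<1+m → cong (λ r → letterWeight (not x) r j * firstCount m u (m ∸ s))
                                     (sym (m∸[m∸n]≡n (s≤s⁻¹ s<1+m)))) ⟩
  ∑< (suc m) (λ s → g (suc m ∸ suc s))
    ≡⟨ ∑<-reverse (suc m) g ⟩
  ∑< (suc m) g
    ≡⟨ ∑<-cong (suc m) (λ s s<1+m → cong (_* firstCount m u s) (letterWeight-not x m s j (s≤s⁻¹ s<1+m) j≤1+m)) ⟩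
  ∑< (suc m) (λ s → letterWeight x s (suc m ∸ j) * firstCount m u s) ∎
  where
  g : ℕ → ℕ
  g s = letterWeight (not x) (m ∸ s) j * firstCount m u s

∑<-firstCount-not : ∀ m u → ∑< (suc m) (firstCount m (map not u)) ≡ ∑< (suc m) (firstCount m u)
∑<-firstCount-not m u =
  trans (∑<-cong (suc m) (λ j j<1+m → firstCount-not m u j (s≤s⁻¹ j<1+m))) (∑<-reverse (suc m) (firstCount m u))

transfer-true-prefix : ∀ N g s → s ≤ N → transfer true N g s ≡ ∑< s g
transfer-true-prefix N g s s≤N = begin
  ∑< N h                                   ≡⟨ cong (λ M → ∑< M h) (sym (m+[n∸m]≡n s≤N)) ⟩
  ∑< (s + (N ∸ s)) h                       ≡⟨ ∑<-+ s (N ∸ s) h ⟩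
  ∑< s h + ∑< (N ∸ s) (λ i → h (s + i))    ≡⟨ cong₂ _+_ (∑<-cong s below) (above (N ∸ s)) ⟩
  ∑< s g + 0                               ≡⟨ +-identityʳ _ ⟩
  ∑< s g                                   ∎
  where
  h : ℕ → ℕ
  h i = letterWeight true i s * g i
  below : ∀ i → i < s → h i ≡ g i
  below i i<s rewrite <⇒<ᵇ≡true i<s = +-identityʳ (g i)
  above : ∀ M → ∑< M (λ i → h (s + i)) ≡ 0
  above M = trans
    (∑<-cong M (λ i _ → cong (λ b → 𝟙 (does (b Bool.≟ true)) * g (s + i)) (≥⇒<ᵇ≡false (m≤m+n s i))))
                     (∑<-zero M)

firstCount-not-alt-anti-≤ : ∀ k i j → i ≤ j → j ≤ k →
  firstCount k (map not (alt k)) j ≤ firstCount k (map not (alt k)) i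
firstCount-not-alt-anti-≤ zero    zero zero _ _ = ≤-refl
firstCount-not-alt-anti-≤ (suc k) i    j    i≤j _ rewrite map-not-alt-suc k =
  ∑<-mono-≤ (suc k) (λ s _ → *-monoˡ-≤ (firstCount k (alt k) s) (letterWeight-false-antiʳ-≤ s i≤j))

module _ (k : ℕ) where

  firstCount-alt-mono-≤ : ∀ i j → i ≤ j → firstCount (suc k) (alt (suc k)) i ≤ firstCount (suc k) (alt (suc k)) j
  firstCount-alt-mono-≤ i j i≤j rewrite alt-suc k =
    ∑<-mono-≤ (suc k) (λ s _ → *-monoˡ-≤ (firstCount k (map not (alt k)) s) (letterWeight-true-monoʳ-≤ s i≤j))

  firstCount-alt-prefix : ∀ s → s ≤ suc k → firstCount (suc k) (alt (suc k)) s ≡ ∑< s (firstCount k (map not (alt k)))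
  firstCount-alt-prefix s s≤1+k rewrite alt-suc k = transfer-true-prefix (suc k) (firstCount k (map not (alt k))) s s≤1+k

  firstCount-alt-subadditive : ∀ s → s ≤ suc k →
    firstCount (suc k) (alt (suc k)) (suc k) ≤ firstCount (suc k) (alt (suc k)) s + firstCount (suc k) (alt (suc k)) (suc k ∸ s)
  firstCount-alt-subadditive s s≤1+k
    rewrite firstCount-alt-prefix s s≤1+k
          | firstCount-alt-prefix (suc k ∸ s) (m∸n≤m (suc k) s)
          | firstCount-alt-prefix (suc k) ≤-refl =
    ∑<-antitone-subadditive (suc k) (firstCount k (map not (alt k)))
      (λ i j i≤j j<1+k → firstCount-not-alt-anti-≤ k i j i≤j (s≤s⁻¹ j<1+k)) s s≤1+k

-- The first-entry recursion computes d

⌊<?⌋≡<ᵇ : ∀ {n} (a b : Fin n) → ⌊ a Fin.<? b ⌋ ≡ (toℕ a <ᵇ toℕ b)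
⌊<?⌋≡<ᵇ a b = trans (⌊⌋-map′ _ _ (T? (toℕ a <ᵇ toℕ b))) (⌊T?⌋ (toℕ a <ᵇ toℕ b))
  where
  ⌊T?⌋ : ∀ b → ⌊ T? b ⌋ ≡ b
  ⌊T?⌋ true  = refl
  ⌊T?⌋ false = refl

allFin-suc : ∀ n → allFin (suc n) ≡ zero ∷ map suc (allFin n)
allFin-suc n = cong (zero ∷_) (sym (ListP.map-tabulate (λ i → i) suc))

_≢ᵇ_ : ∀ {n} → Fin n → Fin n → Bool
j ≢ᵇ y = does (¬? (j FinP.≟ y))

filterᵇ-≢ᵇ-map-suc : ∀ {n} (j : Fin n) (xs : List (Fin n)) →
  filterᵇ (suc j ≢ᵇ_) (map suc xs) ≡ map suc (filterᵇ (j ≢ᵇ_) xs)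
filterᵇ-≢ᵇ-map-suc j []       = refl
filterᵇ-≢ᵇ-map-suc j (x ∷ xs) with does (j FinP.≟ x)
... | true  = filterᵇ-≢ᵇ-map-suc j xs
... | false = cong (suc x ∷_) (filterᵇ-≢ᵇ-map-suc j xs)

filterᵇ-≢ᵇ-allFin : ∀ m (j : Fin (suc m)) → filterᵇ (j ≢ᵇ_) (allFin (suc m)) ≡ map (punchIn j) (allFin m)
filterᵇ-≢ᵇ-allFin m zero = begin
  filterᵇ (zero ≢ᵇ_) (allFin (suc m))       ≡⟨ cong (filterᵇ (zero ≢ᵇ_)) (allFin-suc m) ⟩
  filterᵇ (zero ≢ᵇ_) (map suc (allFin m))   ≡⟨ keep-all (allFin m) ⟩
  map suc (allFin m)                        ∎
  where
  keep-all : ∀ xs → filterᵇ (zero ≢ᵇ_) (map suc xs) ≡ map suc xs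
  keep-all []       = refl
  keep-all (x ∷ xs) = cong (suc x ∷_) (keep-all xs)
filterᵇ-≢ᵇ-allFin (suc m) (suc j) = begin
  filterᵇ (suc j ≢ᵇ_) (allFin (suc (suc m)))                 ≡⟨ cong (filterᵇ (suc j ≢ᵇ_)) (allFin-suc (suc m)) ⟩
  zero ∷ filterᵇ (suc j ≢ᵇ_) (map suc (allFin (suc m)))      ≡⟨ cong (zero ∷_) (filterᵇ-≢ᵇ-map-suc j (allFin (suc m))) ⟩
  zero ∷ map suc (filterᵇ (j ≢ᵇ_) (allFin (suc m)))          ≡⟨ cong (λ xs → zero ∷ map suc xs) (filterᵇ-≢ᵇ-allFin m j) ⟩
  zero ∷ map suc (map (punchIn j) (allFin m))                ≡⟨ cong (zero ∷_) (sym (ListP.map-∘ (allFin m))) ⟩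
  zero ∷ map (λ i → suc (punchIn j i)) (allFin m)            ≡⟨ cong (zero ∷_) (ListP.map-∘ (allFin m)) ⟩
  zero ∷ map (punchIn (suc j)) (map suc (allFin m))          ≡⟨ cong (map (punchIn (suc j))) (sym (allFin-suc m)) ⟩
  map (punchIn (suc j)) (allFin (suc m))                     ∎

∑∈-allVecs-avoiding : ∀ m k (j : Fin (suc m)) (G : Vec (Fin (suc m)) k → ℕ) →
  ∑∈ (allVecs (allFin (suc m)) k) (λ ρ → 𝟙 (all (j ≢ᵇ_) (toList ρ)) * G ρ)
    ≡ ∑∈ (allVecs (allFin m) k) (λ σ → G (Vec.map (punchIn j) σ))
∑∈-allVecs-avoiding m k j G = begin
  ∑∈ (allVecs (allFin (suc m)) k) (λ ρ → 𝟙 (all (j ≢ᵇ_) (toList ρ)) * G ρ)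
    ≡⟨ ∑∈-allVecs-filterᵇ (j ≢ᵇ_) (allFin (suc m)) k G ⟩
  ∑∈ (allVecs (filterᵇ (j ≢ᵇ_) (allFin (suc m))) k) G
    ≡⟨ cong (λ L → ∑∈ (allVecs L k) G) (filterᵇ-≢ᵇ-allFin m j) ⟩
  ∑∈ (allVecs (map (punchIn j) (allFin m)) k) G
    ≡⟨ ∑∈-allVecs-map (punchIn j) (allFin m) k G ⟩
  ∑∈ (allVecs (allFin m) k) (λ σ → G (Vec.map (punchIn j) σ)) ∎

∑∈-allFin : ∀ N (G : ℕ → ℕ) → ∑∈ (allFin N) (λ j → G (toℕ j)) ≡ ∑< N G
∑∈-allFin zero    G = refl
∑∈-allFin (suc N) G = begin
  ∑∈ (allFin (suc N)) (λ j → G (toℕ j))          ≡⟨ cong (λ L → ∑∈ L (λ j → G (toℕ j))) (allFin-suc N) ⟩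
  G 0 + ∑∈ (map suc (allFin N)) (λ j → G (toℕ j)) ≡⟨ cong (G 0 +_) (∑∈-map suc (allFin N) _) ⟩
  G 0 + ∑∈ (allFin N) (λ j → G (suc (toℕ j)))    ≡⟨ cong (G 0 +_) (∑∈-allFin N (λ i → G (suc i))) ⟩
  G 0 + ∑< N (λ i → G (suc i))                   ≡⟨ sym (∑<-suc N G) ⟩
  ∑< (suc N) G                                   ∎

uniqueᵇ : ∀ {n} → List (Fin n) → Bool
uniqueᵇ xs = does (AllPairs.allPairs? (λ x y → ¬? (x FinP.≟ y)) xs)

_==ʷ_ : List Bool → List Bool → Bool
u ==ʷ v = does (ListP.≡-dec Bool._≟_ u v)

uniqueᵇ-map-punchIn : ∀ {n} (j : Fin (suc n)) xs → uniqueᵇ (map (punchIn j) xs) ≡ uniqueᵇ xs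
uniqueᵇ-map-punchIn j xs =
  does-⇔ (mk⇔ (UniqueP.map⁻ {f = punchIn j} {xs = xs}) (UniqueP.map⁺ (FinP.punchIn-injective j _ _)))
         (AllPairs.allPairs? _ (map (punchIn j) xs)) (AllPairs.allPairs? _ xs)

punchIn-<ᵇ : ∀ {n} (j : Fin (suc n)) (a b : Fin n) → (toℕ (punchIn j a) <ᵇ toℕ (punchIn j b)) ≡ (toℕ a <ᵇ toℕ b)
punchIn-<ᵇ zero    a       b       = refl
punchIn-<ᵇ (suc j) zero    zero    = refl
punchIn-<ᵇ (suc j) zero    (suc b) = refl
punchIn-<ᵇ (suc j) (suc a) zero    = refl
punchIn-<ᵇ (suc j) (suc a) (suc b) = punchIn-<ᵇ j a b

punchIn-<ᵇ-pivot : ∀ {n} (j : Fin (suc n)) (a : Fin n) → (toℕ (punchIn j a) <ᵇ toℕ j) ≡ (toℕ a <ᵇ toℕ j)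
punchIn-<ᵇ-pivot zero    a       = refl
punchIn-<ᵇ-pivot (suc j) zero    = refl
punchIn-<ᵇ-pivot (suc j) (suc a) = punchIn-<ᵇ-pivot j a

desL-map-punchIn : ∀ {n} (j : Fin (suc n)) (xs : List (Fin n)) → desL (map (punchIn j) xs) ≡ desL xs
desL-map-punchIn j []           = refl
desL-map-punchIn j (x ∷ [])     = refl
desL-map-punchIn j (x ∷ y ∷ xs) = cong₂ _∷_ descent (desL-map-punchIn j (y ∷ xs))
  where
  descent : ⌊ punchIn j y Fin.<? punchIn j x ⌋ ≡ ⌊ y Fin.<? x ⌋
  descent = trans (⌊<?⌋≡<ᵇ (punchIn j y) (punchIn j x)) (trans (punchIn-<ᵇ j y x) (sym (⌊<?⌋≡<ᵇ y x)))

punchIn-cons : ∀ {m} (j : Fin (suc (suc m))) x u (σ : Vec (Fin (suc m)) (suc m)) →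
  let ρ = toList (Vec.map (punchIn j) σ) in
  uniqueᵇ ρ ∧ (desL (j ∷ ρ) ==ʷ (x ∷ u))
    ≡ does ((toℕ (Vec.head σ) <ᵇ toℕ j) Bool.≟ x) ∧ (does (isPerm? σ) ∧ (Des σ ==ʷ u))
punchIn-cons j x u (s ∷ σ) = begin
  uniqueᵇ ρ ∧ (does (⌊ punchIn j s Fin.<? j ⌋ Bool.≟ x) ∧ (desL ρ ==ʷ u))
    ≡⟨ cong (λ xs → uniqueᵇ xs ∧ (does (⌊ punchIn j s Fin.<? j ⌋ Bool.≟ x) ∧ (desL xs ==ʷ u))) ρ≡ ⟩
  uniqueᵇ (map (punchIn j) σ′) ∧ (does (⌊ punchIn j s Fin.<? j ⌋ Bool.≟ x) ∧ (desL (map (punchIn j) σ′) ==ʷ u))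
    ≡⟨ cong₂ (λ U b → U ∧ (does (b Bool.≟ x) ∧ (desL (map (punchIn j) σ′) ==ʷ u)))
         (uniqueᵇ-map-punchIn j σ′) (trans (⌊<?⌋≡<ᵇ (punchIn j s) j) (punchIn-<ᵇ-pivot j s)) ⟩
  uniqueᵇ σ′ ∧ (does ((toℕ s <ᵇ toℕ j) Bool.≟ x) ∧ (desL (map (punchIn j) σ′) ==ʷ u))
    ≡⟨ cong (λ D → uniqueᵇ σ′ ∧ (does ((toℕ s <ᵇ toℕ j) Bool.≟ x) ∧ (D ==ʷ u))) (desL-map-punchIn j σ′) ⟩
  uniqueᵇ σ′ ∧ (does ((toℕ s <ᵇ toℕ j) Bool.≟ x) ∧ (desL σ′ ==ʷ u))
    ≡⟨ ∧-x∙yz≈y∙xz (uniqueᵇ σ′) (does ((toℕ s <ᵇ toℕ j) Bool.≟ x)) (desL σ′ ==ʷ u) ⟩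
  does ((toℕ s <ᵇ toℕ j) Bool.≟ x) ∧ (uniqueᵇ σ′ ∧ (desL σ′ ==ʷ u)) ∎
  where
  ρ = toList (Vec.map (punchIn j) (s ∷ σ))
  σ′ = toList (s ∷ σ)
  ρ≡ : ρ ≡ map (punchIn j) σ′
  ρ≡ = VecP.toList-map (punchIn j) (s ∷ σ)

permsWith : ℕ → List Bool → (ℕ → Bool) → ℕ
permsWith m u p =
  ∑∈ (allVecs (allFin (suc m)) (suc m)) (λ σ → 𝟙 (p (toℕ (Vec.head σ))) * 𝟙 (does (isPerm? σ) ∧ (Des σ ==ʷ u)))

permsWith-firstCount : ∀ m u p → permsWith m u p ≡ ∑< (suc m) (λ j → 𝟙 (p j) * firstCount m u j)
permsWith-firstCount zero    []      p = +-identityʳ _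
permsWith-firstCount zero    (x ∷ u) p = +-identityʳ _
permsWith-firstCount (suc m) u       p = begin
  permsWith (suc m) u p
    ≡⟨ ∑∈-allVecs-∷ L (suc m) _ ⟩
  ∑∈ L (λ j → ∑∈ (allVecs L (suc m)) (λ ρ → 𝟙 (p (toℕ j)) * 𝟙 (isPermᵇ (j ∷ ρ) ∧ (desL (j ∷ toList ρ) ==ʷ u))))
    ≡⟨ ∑∈-cong L (λ j → ∑∈-cong (allVecs L (suc m)) (split-avoidance j)) ⟩
  ∑∈ L (λ j → ∑∈ (allVecs L (suc m)) (λ ρ → 𝟙 (all (j ≢ᵇ_) (toList ρ)) * G u j ρ))
    ≡⟨ ∑∈-cong L (λ j → ∑∈-allVecs-avoiding (suc m) (suc m) j (G u j)) ⟩
  ∑∈ L (λ j → ∑∈ (allVecs (allFin (suc m)) (suc m)) (λ σ → G u j (Vec.map (punchIn j) σ)))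
    ≡⟨ ∑∈-cong L (λ j → rest u j) ⟩
  ∑∈ L (λ j → 𝟙 (p (toℕ j)) * firstCount (suc m) u (toℕ j))
    ≡⟨ ∑∈-allFin (suc (suc m)) (λ j → 𝟙 (p j) * firstCount (suc m) u j) ⟩
  ∑< (suc (suc m)) (λ j → 𝟙 (p j) * firstCount (suc m) u j) ∎
  where
  L = allFin (suc (suc m))
  isPermᵇ : ∀ {n} → Vec (Fin n) n → Bool
  isPermᵇ v = does (isPerm? v)
  G : List Bool → Fin (suc (suc m)) → Vec (Fin (suc (suc m))) (suc m) → ℕ
  G u j ρ = 𝟙 (p (toℕ j)) * 𝟙 (uniqueᵇ (toList ρ) ∧ (desL (j ∷ toList ρ) ==ʷ u))
  split-avoidance : ∀ j ρ → 𝟙 (p (toℕ j)) * 𝟙 (isPermᵇ (j ∷ ρ) ∧ (desL (j ∷ toList ρ) ==ʷ u))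
                              ≡ 𝟙 (all (j ≢ᵇ_) (toList ρ)) * G u j ρ
  split-avoidance j ρ = begin
    𝟙 (p (toℕ j)) * 𝟙 ((avoids? ∧ U) ∧ D)    ≡⟨ cong (λ b → 𝟙 (p (toℕ j)) * 𝟙 ((b ∧ U) ∧ D)) (does-all? (λ y → ¬? (j FinP.≟ y)) (toList ρ)) ⟩
    𝟙 (p (toℕ j)) * 𝟙 ((avoids ∧ U) ∧ D)     ≡⟨ cong (λ b → 𝟙 (p (toℕ j)) * 𝟙 b) (BoolP.∧-assoc avoids U D) ⟩
    𝟙 (p (toℕ j)) * 𝟙 (avoids ∧ (U ∧ D))     ≡⟨ cong (𝟙 (p (toℕ j)) *_) (𝟙-∧ avoids (U ∧ D)) ⟩
    𝟙 (p (toℕ j)) * (𝟙 avoids * 𝟙 (U ∧ D))   ≡⟨ *-x∙yz≈y∙xz (𝟙 (p (toℕ j))) (𝟙 avoids) (𝟙 (U ∧ D)) ⟩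
    𝟙 avoids * G u j ρ                       ∎
    where
    avoids? = does (All.all? (λ y → ¬? (j FinP.≟ y)) (toList ρ))
    avoids = all (j ≢ᵇ_) (toList ρ)
    U = uniqueᵇ (toList ρ)
    D = desL (j ∷ toList ρ) ==ʷ u
  rest : ∀ u j → ∑∈ (allVecs (allFin (suc m)) (suc m)) (λ σ → G u j (Vec.map (punchIn j) σ))
                   ≡ 𝟙 (p (toℕ j)) * firstCount (suc m) u (toℕ j)
  rest [] j = trans (∑∈-zero (allVecs (allFin (suc m)) (suc m)) no-descent-word) (sym (*-zeroʳ (𝟙 (p (toℕ j)))))
    where
    no-descent-word : ∀ σ → G [] j (Vec.map (punchIn j) σ) ≡ 0
    no-descent-word (s ∷ σ) = trans (cong (λ b → 𝟙 (p (toℕ j)) * 𝟙 b) (BoolP.∧-zeroʳ _)) (*-zeroʳ (𝟙 (p (toℕ j))))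
  rest (x ∷ u) j = begin
    ∑∈ Vs (λ σ → G (x ∷ u) j (Vec.map (punchIn j) σ))
      ≡⟨ ∑∈-cong Vs (λ σ → trans (cong (λ b → 𝟙 (p (toℕ j)) * 𝟙 b) (punchIn-cons j x u σ))
                                  (cong (𝟙 (p (toℕ j)) *_) (𝟙-∧ (q (toℕ (Vec.head σ))) _))) ⟩
    ∑∈ Vs (λ σ → 𝟙 (p (toℕ j)) * (𝟙 (q (toℕ (Vec.head σ))) * 𝟙 (does (isPerm? σ) ∧ (Des σ ==ʷ u))))
      ≡⟨ ∑∈-*-distribˡ Vs (𝟙 (p (toℕ j))) _ ⟩
    𝟙 (p (toℕ j)) * permsWith m u q
      ≡⟨ cong (𝟙 (p (toℕ j)) *_) (permsWith-firstCount m u q) ⟩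
    𝟙 (p (toℕ j)) * firstCount (suc m) (x ∷ u) (toℕ j) ∎
    where
    Vs = allVecs (allFin (suc m)) (suc m)
    q : ℕ → Bool
    q s = does ((s <ᵇ toℕ j) Bool.≟ x)

d≡∑<-firstCount : ∀ m u → d (suc m) u ≡ ∑< (suc m) (firstCount m u)
d≡∑<-firstCount m u = begin
  d (suc m) u
    ≡⟨ length-filter _ (allVecs (allFin (suc m)) (suc m)) ⟩
  ∑∈ (allVecs (allFin (suc m)) (suc m)) (λ σ → 𝟙 (does (isPerm? σ) ∧ (Des σ ==ʷ u)))
    ≡⟨ sym (∑∈-cong (allVecs (allFin (suc m)) (suc m)) (λ σ → +-identityʳ _)) ⟩
  permsWith m u (λ _ → true)
    ≡⟨ permsWith-firstCount m u (λ _ → true) ⟩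
  ∑< (suc m) (λ j → 1 * firstCount m u j)
    ≡⟨ ∑<-cong (suc m) (λ j _ → *-identityˡ (firstCount m u j)) ⟩
  ∑< (suc m) (firstCount m u) ∎

firstCount-alt-last : ∀ k → firstCount (suc k) (alt (suc k)) (suc k) ≡ E (suc k)
firstCount-alt-last k = begin
  firstCount (suc k) (alt (suc k)) (suc k)   ≡⟨ firstCount-alt-prefix k (suc k) ≤-refl ⟩
  ∑< (suc k) (firstCount k (map not (alt k))) ≡⟨ ∑<-firstCount-not k (alt k) ⟩
  ∑< (suc k) (firstCount k (alt k))           ≡⟨ sym (d≡∑<-firstCount k (alt k)) ⟩
  E (suc k)                                   ∎

-- Reversing permutations

Unique-reverse⁺ : {xs : List A} → Unique xs → Unique (reverse xs)
Unique-reverse⁺ {A} {xs} = PermP.Unique-resp-↭ (setoid A) (Perm.↭-sym (setoid A) (PermP.↭-reverse (setoid A) xs))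

Unique-reverse⁻ : {xs : List A} → Unique (reverse xs) → Unique xs
Unique-reverse⁻ {A} {xs} = PermP.Unique-resp-↭ (setoid A) (PermP.↭-reverse (setoid A) xs)

uniqueᵇ-reverse : ∀ {n} (xs : List (Fin n)) → uniqueᵇ (reverse xs) ≡ uniqueᵇ xs
uniqueᵇ-reverse xs = does-⇔ (mk⇔ Unique-reverse⁻ Unique-reverse⁺) (AllPairs.allPairs? _ (reverse xs)) (AllPairs.allPairs? _ xs)

==ʷ-reverseComplement : ∀ u v → (reverseComplement u ==ʷ v) ≡ (u ==ʷ reverseComplement v)
==ʷ-reverseComplement u v = does-⇔
  (mk⇔ (λ eq → trans (sym (reverseComplement-involutive u)) (cong reverseComplement eq))
       (λ eq → trans (cong reverseComplement eq) (reverseComplement-involutive v)))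
  (ListP.≡-dec Bool._≟_ (reverseComplement u) v) (ListP.≡-dec Bool._≟_ u (reverseComplement v))

desL-∷ʳ-∷ʳ : ∀ {n} (zs : List (Fin n)) y x → desL ((zs ∷ʳ y) ∷ʳ x) ≡ desL (zs ∷ʳ y) ∷ʳ ⌊ x Fin.<? y ⌋
desL-∷ʳ-∷ʳ []            y x = refl
desL-∷ʳ-∷ʳ (z ∷ [])      y x = refl
desL-∷ʳ-∷ʳ (z ∷ z′ ∷ zs) y x = cong (_ ∷_) (desL-∷ʳ-∷ʳ (z′ ∷ zs) y x)

⌊<?⌋-flip : ∀ {n} (x y : Fin n) → x ≢ y → ⌊ x Fin.<? y ⌋ ≡ not ⌊ y Fin.<? x ⌋
⌊<?⌋-flip x y x≢y = begin
  ⌊ x Fin.<? y ⌋             ≡⟨ ⌊<?⌋≡<ᵇ x y ⟩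
  toℕ x <ᵇ toℕ y             ≡⟨ <ᵇ-flip (toℕ x) (toℕ y) (x≢y ∘′ FinP.toℕ-injective) ⟩
  not (toℕ y <ᵇ toℕ x)       ≡⟨ cong not (sym (⌊<?⌋≡<ᵇ y x)) ⟩
  not ⌊ y Fin.<? x ⌋         ∎
  where
  <ᵇ-flip : ∀ m n → m ≢ n → (m <ᵇ n) ≡ not (n <ᵇ m)
  <ᵇ-flip zero    zero    m≢n = ⊥-elim (m≢n refl)
  <ᵇ-flip zero    (suc n) _   = refl
  <ᵇ-flip (suc m) zero    _   = refl
  <ᵇ-flip (suc m) (suc n) m≢n = <ᵇ-flip m n (m≢n ∘′ cong suc)

desL-reverse : ∀ {n} (xs : List (Fin n)) → Unique xs → desL (reverse xs) ≡ reverseComplement (desL xs)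
desL-reverse []           _                  = refl
desL-reverse (x ∷ [])     _                  = refl
desL-reverse (x ∷ y ∷ zs) (x∉ AllPairs.∷ !ys) = begin
  desL (reverse (x ∷ y ∷ zs))
    ≡⟨ cong desL (trans (ListP.unfold-reverse x (y ∷ zs)) (cong (_∷ʳ x) (ListP.unfold-reverse y zs))) ⟩
  desL ((reverse zs ∷ʳ y) ∷ʳ x)
    ≡⟨ desL-∷ʳ-∷ʳ (reverse zs) y x ⟩
  desL (reverse zs ∷ʳ y) ∷ʳ ⌊ x Fin.<? y ⌋
    ≡⟨ cong₂ _∷ʳ_ (trans (cong desL (sym (ListP.unfold-reverse y zs))) (desL-reverse (y ∷ zs) !ys))
                  (⌊<?⌋-flip x y (All.head x∉)) ⟩
  reverseComplement (desL (y ∷ zs)) ∷ʳ not ⌊ y Fin.<? x ⌋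
    ≡⟨ sym (reverseComplement-∷ ⌊ y Fin.<? x ⌋ (desL (y ∷ zs))) ⟩
  reverseComplement (desL (x ∷ y ∷ zs)) ∎

d-reverseComplement : ∀ m u → d m u ≡ d m (reverseComplement u)
d-reverseComplement m u = begin
  d m u
    ≡⟨ length-filter _ Vs ⟩
  ∑∈ Vs (λ v → 𝟙 (does (isPerm? v) ∧ (Des v ==ʷ u)))
    ≡⟨ sym (∑∈-allVecs-reverse (allFin m) m _) ⟩
  ∑∈ Vs (λ v → 𝟙 (does (isPerm? (Vec.reverse v)) ∧ (Des (Vec.reverse v) ==ʷ u)))
    ≡⟨ ∑∈-cong Vs (λ v → cong 𝟙 (reversed v)) ⟩
  ∑∈ Vs (λ v → 𝟙 (does (isPerm? v) ∧ (Des v ==ʷ reverseComplement u)))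
    ≡⟨ sym (length-filter _ Vs) ⟩
  d m (reverseComplement u) ∎
  where
  Vs = allVecs (allFin m) m
  reversed : ∀ v → does (isPerm? (Vec.reverse v)) ∧ (Des (Vec.reverse v) ==ʷ u)
                   ≡ does (isPerm? v) ∧ (Des v ==ʷ reverseComplement u)
  reversed v rewrite VecP.toList-reverse v | uniqueᵇ-reverse (toList v) with isPerm? v
  ... | no  _    = refl
  ... | yes !v = trans (cong (_==ʷ u) (desL-reverse (toList v) !v)) (==ʷ-reverseComplement (Des v) u)

-- Descent words with a prescribed prefix

d-++-prefixWeight : ∀ w k p → d (suc (length w) + k) (w ++ p) ≡ ∑< (suc k) (λ s → firstCount k p s * prefixWeight w (suc k) s)
d-++-prefixWeight w k p = begin
  d (suc (n + k)) (w ++ p)                          ≡⟨ d≡∑<-firstCount (n + k) (w ++ p) ⟩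
  ∑< (suc (n + k)) (firstCount (n + k) (w ++ p))     ≡⟨ ∑<-cong (suc (n + k)) (λ j _ → firstCount-++ w k p j) ⟩
  ∑< (suc (n + k)) (transferWord w (suc k) (firstCount k p))
    ≡⟨ cong (λ N → ∑< N (transferWord w (suc k) (firstCount k p))) (sym (+-suc n k)) ⟩
  ∑< (n + suc k) (transferWord w (suc k) (firstCount k p))
    ≡⟨ ∑<-transferWord w (suc k) (firstCount k p) ⟩
  ∑< (suc k) (λ s → firstCount k p s * prefixWeight w (suc k) s) ∎
  where n = length w

∑∈-allWords-d-++ : ∀ w k →
  ∑∈ (allWords k) (λ p → d (suc (length w) + k) (w ++ p)) ≡ k ! * ∑< (suc k) (prefixWeight w (suc k))
∑∈-allWords-d-++ w k = begin
  ∑∈ (allWords k) (λ p → d (suc (length w) + k) (w ++ p))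
    ≡⟨ ∑∈-cong (allWords k) (d-++-prefixWeight w k) ⟩
  ∑∈ (allWords k) (λ p → ∑< (suc k) (λ s → firstCount k p s * φ s))
    ≡⟨ ∑∈-∑< (allWords k) (suc k) _ ⟩
  ∑< (suc k) (λ s → ∑∈ (allWords k) (λ p → firstCount k p s * φ s))
    ≡⟨ ∑<-cong (suc k) (λ s s<1+k → trans (∑∈-*-distribʳ (allWords k) (φ s) _)
                                          (cong (_* φ s) (∑∈-allWords-firstCount k s (s≤s⁻¹ s<1+k)))) ⟩
  ∑< (suc k) (λ s → k ! * φ s)
    ≡⟨ ∑<-*-distribˡ (suc k) (k !) φ ⟩
  k ! * ∑< (suc k) φ ∎
  where
  φ = prefixWeight w (suc k)

∑∈-allWords-d-prefix : ∀ v k →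
  ∑∈ (allWords k) (λ p → d (suc (length v) + k) (p ++ v)) ≡ risingFactorial (suc (length v)) k * d (suc (length v)) v
∑∈-allWords-d-prefix v k = begin
  ∑∈ (allWords k) (λ p → d (suc (n + k)) (p ++ v))
    ≡⟨ ∑∈-allWords-cong k (λ p ∣p∣≡k → trans (cong (λ m → d (suc m) (p ++ v)) (trans (+-comm n k) (cong (_+ n) (sym ∣p∣≡k))))
                                                (total p)) ⟩
  ∑∈ (allWords k) (λ p → ∑< (length p + suc n) (transferWord p (suc n) (firstCount n v)))
    ≡⟨ ∑∈-allWords-transferWord k (suc n) (firstCount n v) ⟩
  risingFactorial (suc n) k * ∑< (suc n) (firstCount n v)
    ≡⟨ cong (risingFactorial (suc n) k *_) (sym (d≡∑<-firstCount n v)) ⟩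
  risingFactorial (suc n) k * d (suc n) v ∎
  where
  n = length v
  total : ∀ p → d (suc (length p + n)) (p ++ v) ≡ ∑< (length p + suc n) (transferWord p (suc n) (firstCount n v))
  total p = begin
    d (suc (length p + n)) (p ++ v)                            ≡⟨ d≡∑<-firstCount (length p + n) (p ++ v) ⟩
    ∑< (suc (length p + n)) (firstCount (length p + n) (p ++ v)) ≡⟨ ∑<-cong _ (λ j _ → firstCount-++ p n v j) ⟩
    ∑< (suc (length p + n)) (transferWord p (suc n) (firstCount n v))
      ≡⟨ cong (λ N → ∑< N (transferWord p (suc n) (firstCount n v))) (sym (+-suc (length p) n)) ⟩
    ∑< (length p + suc n) (transferWord p (suc n) (firstCount n v)) ∎

-- The total weight is computed by moving the free letters to the front, using the
-- reverse-complement symmetry of descent classes.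
∑<-prefixWeight : ∀ w k → ∑< (suc k) (prefixWeight w (suc k)) ≡ ((suc (length w) + k) C k) * d (suc (length w)) w
∑<-prefixWeight w k = *-cancelˡ-≡ _ _ (k !) {{k !≢0}} (begin
  k ! * ∑< (suc k) (prefixWeight w (suc k))
    ≡⟨ sym (∑∈-allWords-d-++ w k) ⟩
  ∑∈ (allWords k) (λ p → d (n + k) (w ++ p))
    ≡⟨ ∑∈-cong (allWords k) (λ p → trans (d-reverseComplement (n + k) (w ++ p)) (cong (d (n + k)) (reverseComplement-++ w p))) ⟩
  ∑∈ (allWords k) (λ p → d (n + k) (reverseComplement p ++ w̃))
    ≡⟨ ∑∈-allWords-reverseComplement k (λ p → d (n + k) (p ++ w̃)) ⟩
  ∑∈ (allWords k) (λ p → d (n + k) (p ++ w̃))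
    ≡⟨ subst (λ m → ∑∈ (allWords k) (λ p → d (suc m + k) (p ++ w̃)) ≡ risingFactorial (suc m) k * d (suc m) w̃)
             (length-reverseComplement w) (∑∈-allWords-d-prefix w̃ k) ⟩
  risingFactorial n k * d n w̃
    ≡⟨ cong₂ _*_ (sym (k!*[n+k]Ck≡risingFactorial k n)) (sym (d-reverseComplement n w)) ⟩
  k ! * ((n + k) C k) * d n w
    ≡⟨ *-assoc (k !) _ _ ⟩
  k ! * (((n + k) C k) * d n w) ∎)
  where
  n = suc (length w)
  w̃ = reverseComplement w

d-++-zeros-≤ : ∀ w k → d (suc (length w) + k) (w ++ zeros k) ≤ ((suc (length w) + k) C k) * d (suc (length w)) w
d-++-zeros-≤ w k = ≤-trans (≤-reflexive (d-++-prefixWeight w k (zeros k)))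
  (≤-trans (∑<-mono-≤ (suc k) (λ s _ → only-rank-0 s)) (≤-reflexive (∑<-prefixWeight w k)))
  where
  φ = prefixWeight w (suc k)
  only-rank-0 : ∀ s → firstCount k (zeros k) s * φ s ≤ φ s
  only-rank-0 s = subst (λ c → c * φ s ≤ φ s) (sym (firstCount-zeros k s))
    (≤-trans (*-monoˡ-≤ (φ s) (𝟙≤1 (s ≡ᵇ 0))) (≤-reflexive (*-identityˡ (φ s))))

last≡just⇒∷ʳ : ∀ (w : List A) {x} → last w ≡ just x → ∃ λ w′ → w ≡ w′ ∷ʳ x
last≡just⇒∷ʳ (y ∷ [])     refl = [] , refl
last≡just⇒∷ʳ (y ∷ z ∷ ws) eq with last≡just⇒∷ʳ (z ∷ ws) eq
... | w′ , eq = y ∷ w′ , cong (y ∷_) eq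

d-++-alt-≥ : ∀ w k → last w ≡ just false →
  ((suc (length w) + suc k) C suc k) * E (suc k) * d (suc (length w)) w ≤ 2 * d (suc (length w) + suc k) (w ++ alt (suc k))
d-++-alt-≥ w k last-ascent with last≡just⇒∷ʳ w last-ascent
... | w′ , refl = ≤-trans (≤-reflexive rearrange)
  (≤-trans (chebyshev-≤ (suc k) a φ (λ i j i≤j _ → firstCount-alt-mono-≤ k i j i≤j) φ-mono (firstCount-alt-subadditive k))
           (≤-reflexive (cong (2 *_) (sym (d-++-prefixWeight w (suc k) (alt (suc k)))))))
  where
  a = firstCount (suc k) (alt (suc k))
  φ = prefixWeight w (suc (suc k))
  n = suc (length w)
  φ-mono : ∀ i j → i ≤ j → j ≤ suc k → φ i ≤ φ j
  φ-mono i j i≤j j≤1+k = prefixWeight-mono-≤ w′ (suc (suc k)) i≤j (s≤s j≤1+k)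
  rearrange : ((n + suc k) C suc k) * E (suc k) * d n w ≡ a (suc k) * ∑< (suc (suc k)) φ
  rearrange = begin
    ((n + suc k) C suc k) * E (suc k) * d n w     ≡⟨ cong (_* d n w) (*-comm ((n + suc k) C suc k) (E (suc k))) ⟩
    E (suc k) * ((n + suc k) C suc k) * d n w     ≡⟨ *-assoc (E (suc k)) _ _ ⟩
    E (suc k) * (((n + suc k) C suc k) * d n w)   ≡⟨ cong₂ _*_ (sym (firstCount-alt-last k)) (sym (∑<-prefixWeight w (suc k))) ⟩
    a (suc k) * ∑< (suc (suc k)) φ                ∎

lemma3p4 : (n k : ℕ) → 1 ≤ n → 1 ≤ k → (w : List Bool) → length w ≡ n ∸ 1 →
    (d (n + k) (w ++ zeros k) ≤ ((n + k) C k) * d n w)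
    × (last w ≡ just false → ((n + k) C k) * E k * d n w ≤ 2 * d (n + k) (w ++ alt k))
lemma3p4 (suc .(length w)) (suc k) _ _ w refl = d-++-zeros-≤ w (suc k) , d-++-alt-≥ w k
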